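{- Let $d\geq1$ and $1\leq i\leq d$. For each alcove $A$ of $\Delta_{i,d}$, the sequence $\sigma^{(i)}_A$ is a permutation of $[d]$ with exactly $i-1$ descents, and the map $\sigma^{(i)}_\bullet:\mathcal{A}(\Delta_{i,d})\to\mathfrak{A}(d,i)$, $A\mapsto\sigma^{(i)}_A$, is a bijection.
   Context: $\Delta_{i,d}=\{x\in\mathbb{R}^{d+1}:0\leq x_k\leq1,\ \sum_kx_k=i\}$. Its alcoves $\mathcal{A}(\Delta_{i,d})$ are the maximal simplices of the subdivision by the hyperplanes $x_{a+1}+\dots+x_b=m$ ($0\leq a<b\leq d+1$, $m\in\mathbb{Z}$), identified with vertex sets $A=\{\vec a_1,\dots,\vec a_{d+1}\}\subset\{0,1\}^{d+1}$. Each $\vec a$ corresponds to the $i$-subset $I_{\vec a}=\{t:a_t=1\}=\{I_{1}<\dots<I_{i}\}$ of $[d+1]$. The vertices are ordered so the collection is sorted: $I_{11}\leq I_{21}\leq\dots\leq I_{(d+1)1}\leq I_{12}\leq\dots\leq I_{(d+1)i}$, where row $a$ is $I_{\vec a_a}=\{I_{a1}<\dots<I_{ai}\}$. The decorated matrix is the $(d+1)\times i$ grid with these rows where the edge between cells $(a,b)$ and $(a+1,b)$ is marked iff $I_{ab}<I_{(a+1)b}$. $\sigma^{(i)}_A$ is the word listing, for the marks read in order (columns left to right, within a column top to bottom), the index $a$ such that the mark lies between rows $a$ and $a+1$. $\mathfrak{A}(d,i)$ is the set of permutations of $[d]$ with exactly $i-1$ descents. -}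

module Defs where

open import Data.Bool using (Bool; true; false; if_then_else_)
open import Data.Nat using (ℕ; zero; suc; _+_; _∸_; _≤_; _<_; _<ᵇ_)
open import Data.Integer as ℤ using (ℤ)
open import Data.Fin using (Fin; zero; suc; toℕ)
open import Data.Vec as V using (Vec; []; _∷_)
open import Data.List as L using (List; []; _∷_; upTo; concatMap; length)
open import Data.Nat.ListAction using (sum)
open import Data.List.Relation.Binary.Permutation.Propositional using (_↭_)
open import Data.List.Membership.Propositional using (_∈_)
open import Data.List.Relation.Unary.All using (All)
open import Data.Product using (Σ; _×_)
open import Relation.Nullary using (¬_)
open import Relation.Binary.PropositionalEquality using (_≡_)

-- Points of {0,1}^(d+1) are vectors of booleans (true = coordinate 1).

Pt : ℕ → Set
Pt n = Vec Bool n

b2n : Bool → ℕ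
b2n true  = 1
b2n false = 0

weight : ∀ {n} → Pt n → ℕ
weight v = sum (L.map b2n (V.toList v))

-- x_{a+1} + ... + x_b   (coordinates 1-indexed)
isum : ∀ {n} → ℕ → ℕ → Pt n → ℕ
isum a b v = sum (L.take (b ∸ a) (L.drop a (L.map b2n (V.toList v))))

-- 1-indexed positions of the ones: the subset I_v = {I_1 < ... < I_i}
positionsFrom : ℕ → List Bool → List ℕ
positionsFrom k []            = []
positionsFrom k (true  ∷ bs)  = suc k ∷ positionsFrom (suc k) bs
positionsFrom k (false ∷ bs)  = positionsFrom (suc k) bs

positions : ∀ {n} → Pt n → List ℕ
positions v = positionsFrom 0 (V.toList v)

sign : ∀ {m} → Fin m → ℤ
sign zero    = ℤ.1ℤ
sign (suc j) = ℤ.- sign j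

det : ∀ {m} → Vec (Vec ℤ m) m → ℤ
det {zero}  []       = ℤ.1ℤ
det {suc m} (r ∷ rs) =
  V.foldr (λ _ → ℤ) ℤ._+_ ℤ.0ℤ
    (V.tabulate (λ j → sign j ℤ.* V.lookup r j ℤ.* det (V.map (λ row → V.removeAt row j) rs)))

b2z : Bool → ℤ
b2z true  = ℤ.1ℤ
b2z false = ℤ.0ℤ

toMatrix : ∀ {m n} → Vec (Pt n) m → Vec (Vec ℤ n) m
toMatrix = V.map (V.map b2z)

-- Strict lexicographic order on points (false < true); used only to
-- list a finite set of points canonically (as a strictly increasing vector).

data _<lex_ : ∀ {n} → Pt n → Pt n → Set where
  here : ∀ {n} {u v : Pt n} → (false ∷ u) <lex (true ∷ v)
  there : ∀ {n} {b} {u v : Pt n} → u <lex v → (b ∷ u) <lex (b ∷ v)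

data StrictlyIncreasing {n} : ∀ {m} → Vec (Pt n) m → Set where
  []  : StrictlyIncreasing []
  [_] : ∀ u → StrictlyIncreasing (u ∷ [])
  _∷_ : ∀ {m u v} {vs : Vec (Pt n) m} → u <lex v →
        StrictlyIncreasing (v ∷ vs) → StrictlyIncreasing (u ∷ v ∷ vs)

-- Alcoves of Δ_{i,d}: a set A of d+1 vertices of Δ_{i,d} (0/1 vectors
-- with coordinate sum i), listed canonically, spanning a d-simplex
-- (affinely independent; since all lie on Σx = i ≥ 1 this is
-- nonvanishing of the determinant), and not separated by any hyperplane
-- x_{a+1}+...+x_b = m, i.e. each such functional varies by ≤ 1 on A.

record Alcove (d i : ℕ) : Set where
  field
    verts  : Vec (Pt (suc d)) (suc d)
    canon  : StrictlyIncreasing verts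
    inΔ    : All (λ v → weight v ≡ i) (V.toList verts)
    indep  : ¬ (det (toMatrix verts) ≡ ℤ.0ℤ)
    inCell : ∀ a b → a < b → b ≤ suc d →
             ∀ u v → u ∈ V.toList verts → v ∈ V.toList verts →
             isum a b u ≤ isum a b v + 1

nth : List ℕ → ℕ → ℕ
nth []       _       = 0
nth (x ∷ xs) zero    = x
nth (x ∷ xs) (suc k) = nth xs k

nthL : List (List ℕ) → ℕ → List ℕ
nthL []       _       = []
nthL (x ∷ xs) zero    = x
nthL (x ∷ xs) (suc k) = nthL xs k

-- entry I_{(a+1)(b+1)} of the matrix whose rows are the ordered vertices
-- (rows a and columns b are 0-indexed here)
entry : ∀ {m n} → Vec (Pt n) m → ℕ → ℕ → ℕ
entry R a b = nth (nthL (L.map positions (V.toList R)) a) b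

Sorted : (d i : ℕ) → Vec (Pt (suc d)) (suc d) → Set
Sorted d i R =
  (∀ a b → a < d → b < i → entry R a b ≤ entry R (suc a) b) ×
  (∀ b → suc b < i → entry R d b ≤ entry R 0 (suc b))

-- σ^{(i)}: for each column b (left to right), each a = 1..d (top to bottom)
-- such that the edge between rows a and a+1 in column b is marked
-- (I_{ab} < I_{(a+1)b}), output a.
markWord : (d i : ℕ) → Vec (Pt (suc d)) (suc d) → List ℕ
markWord d i R =
  concatMap (λ b → concatMap (λ a →
      if entry R a b <ᵇ entry R (suc a) b then suc a ∷ [] else [])
    (upTo d)) (upTo i)

SigmaOf : ∀ {d i} → Alcove d i → List ℕ → Set
SigmaOf {d} {i} A w =
  Σ (Vec (Pt (suc d)) (suc d)) λ R →
    (V.toList R ↭ V.toList (Alcove.verts A)) × Sorted d i R × (markWord d i R ≡ w)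

descents : List ℕ → ℕ
descents []           = 0
descents (x ∷ [])     = 0
descents (x ∷ y ∷ ys) = (if y <ᵇ x then 1 else 0) + descents (y ∷ ys)

Eulerian : (d i : ℕ) → List ℕ → Set
Eulerian d i w = (w ↭ L.map suc (upTo d)) × (descents w ≡ i ∸ 1)

{-# OPTIONS --safe #-}

-- Write Y_c(v) = v₁ + ⋯ + v_c for the prefix sums of a 0/1 vector. No hyperplane
-- Y_b − Y_a = m separates two vertices u, v of an alcove, which forces Y(u) ≤ Y(v)
-- or Y(v) ≤ Y(u) coordinatewise, and Y(last) ≤ Y(first) + 1 on 1, …, d. Listed
-- lexicographically, the d + 1 vertices therefore form a chain in which each
-- vertex arises from the previous one by moving a single one a single step to the
-- left, running from 0z1 to 1z0. In the decorated matrix (the chain read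
-- backwards) rows a and a + 1 differ in exactly one column, so σ lists each of
-- 1, …, d once, and the letter a + 1 stands in σ at the coordinate of the move
-- between those rows. Conversely a permutation w fixes the coordinate of every
-- move; every coordinate of every row is then determined by when a one arrives
-- and when it leaves, the first row is 1z0 with z the descent vector of w (so
-- the vertices have weight i exactly when w has i − 1 descents), and they are
-- affinely independent because consecutive differences are e_{p+1} − e_p for
-- distinct p.

module Submission where

open import Defs
open import Data.Nat using (ℕ; _≤_)
open import Data.List using (List)
open import Data.Vec using (Vec)
open import Data.Product using (Σ; _×_)
open import Relation.Binary.PropositionalEquality using (_≡_)

-- Determinants

module Determinant where

  open import Data.Integer as ℤ using (ℤ; _+_; _*_; -_; _-_; 0ℤ; 1ℤ; -1ℤ)
  open import Data.Integer.Properties using (*-zeroʳ; *-zeroˡ; *-distribˡ-+; neg-distrib-+; neg-involutive; +-identityʳ)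
  open import Data.Integer.Tactic.RingSolver using (solve-∀)
  open import Data.Fin using (Fin; zero; suc; punchOut; inject₁)
  open import Data.Fin.Properties using (punchOut-injective; _≟_)
  open import Data.Vec using (Vec; []; _∷_; lookup; removeAt; zipWith; map; head; tail; replicate; foldr; tabulate)
  open import Data.Vec.Properties using (lookup-replicate; lookup-zipWith)
  open import Data.Vec.Relation.Unary.All using (All; []; _∷_)
  open import Data.Vec.Relation.Unary.AllPairs using ([]; _∷_)
  open import Data.Vec.Relation.Unary.Unique.Propositional using (Unique)
  open import Data.Nat as ℕ using (ℕ; suc)
  open import Data.Product using (_×_; _,_; proj₁; proj₂)
  open import Data.Sum using (_⊎_; inj₁; inj₂)
  open import Data.Empty using (⊥-elim)
  open import Relation.Nullary using (yes; no)
  open import Relation.Binary.PropositionalEquality using (_≡_; _≢_; refl; sym; trans; cong; cong₂; module ≡-Reasoning)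
  open import Function using (_∘_)
  open ≡-Reasoning

  private variable
    m n : ℕ

  ∑ : (Fin n → ℤ) → ℤ
  ∑ f = foldr (λ _ → ℤ) _+_ 0ℤ (tabulate f)

  ∑-cong : {f g : Fin n → ℤ} → (∀ j → f j ≡ g j) → ∑ f ≡ ∑ g
  ∑-cong {ℕ.zero} h = refl
  ∑-cong {suc n} h = cong₂ _+_ (h zero) (∑-cong (h ∘ suc))

  ∑-distrib-+ : (f g : Fin n → ℤ) → ∑ (λ j → f j + g j) ≡ ∑ f + ∑ g
  ∑-distrib-+ {ℕ.zero} f g = refl
  ∑-distrib-+ {suc n} f g = trans (cong ((f zero + g zero) +_) (∑-distrib-+ (f ∘ suc) (g ∘ suc)))
                                  (interchange (f zero) (g zero) (∑ (f ∘ suc)) (∑ (g ∘ suc)))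
    where
    interchange : ∀ a b c d → (a + b) + (c + d) ≡ (a + c) + (b + d)
    interchange = solve-∀

  ∑-*ˡ : ∀ x (f : Fin n → ℤ) → ∑ (λ j → x * f j) ≡ x * ∑ f
  ∑-*ˡ {ℕ.zero} x f = sym (*-zeroʳ x)
  ∑-*ˡ {suc n} x f = trans (cong (x * f zero +_) (∑-*ˡ x (f ∘ suc))) (sym (*-distribˡ-+ x (f zero) _))

  ∑-neg : (f : Fin n → ℤ) → ∑ (λ j → - f j) ≡ - ∑ f
  ∑-neg {ℕ.zero} f = refl
  ∑-neg {suc n} f = trans (cong (- f zero +_) (∑-neg (f ∘ suc))) (sym (neg-distrib-+ (f zero) _))

  ∑-zero : (f : Fin n → ℤ) → (∀ j → f j ≡ 0ℤ) → ∑ f ≡ 0ℤ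
  ∑-zero {ℕ.zero} f h = refl
  ∑-zero {suc n} f h = cong₂ _+_ (h zero) (∑-zero (f ∘ suc) (h ∘ suc))

  minor : Fin (suc n) → Vec (Vec ℤ (suc n)) m → Vec (Vec ℤ n) m
  minor j = map (λ row → removeAt row j)

  -- Expansion along the first one (resp. two) rows, with the determinant of
  -- the remaining block abstracted as φ, so that antisymmetry in the first
  -- two rows can be proved by induction on the number of columns.
  expand₁ : (Vec (Vec ℤ n) m → ℤ) → Vec ℤ (suc n) → Vec (Vec ℤ (suc n)) m → ℤ
  expand₁ φ x T = ∑ (λ k → sign k * lookup x k * φ (minor k T))

  expand₂ : (Vec (Vec ℤ n) m → ℤ) → Vec ℤ (suc (suc n)) → Vec ℤ (suc (suc n)) → Vec (Vec ℤ (suc (suc n))) m → ℤ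
  expand₂ φ r s T = ∑ (λ j → sign j * lookup r j * expand₁ φ (removeAt s j) (minor j T))

  minor-zero : (T : Vec (Vec ℤ (suc n)) m) → minor zero T ≡ map tail T
  minor-zero [] = refl
  minor-zero ((x ∷ xs) ∷ T) = cong (xs ∷_) (minor-zero T)

  minor-zero-suc : (j : Fin (suc n)) (T : Vec (Vec ℤ (suc (suc n))) m) →
                   minor zero (minor (suc j) T) ≡ minor j (map tail T)
  minor-zero-suc j [] = refl
  minor-zero-suc j ((x ∷ y ∷ xs) ∷ T) = cong (removeAt (y ∷ xs) j ∷_) (minor-zero-suc j T)

  minor-suc-suc : (j : Fin (suc (suc n))) (k : Fin (suc n)) (T : Vec (Vec ℤ (suc (suc (suc n)))) m) →
                  minor (suc k) (minor (suc j) T) ≡ zipWith _∷_ (map head T) (minor k (minor j (map tail T)))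
  minor-suc-suc j k [] = refl
  minor-suc-suc j k ((x ∷ y ∷ xs) ∷ T) = cong₂ _∷_ (removeAt-suc (removeAt (y ∷ xs) j) k) (minor-suc-suc j k T)
    where
    removeAt-suc : ∀ {n} (ys : Vec ℤ (suc n)) k → removeAt (x ∷ ys) (suc k) ≡ x ∷ removeAt ys k
    removeAt-suc (y ∷ ys) k = refl

  expand₂-split : ∀ (φ : Vec (Vec ℤ (suc n)) m → ℤ) r₀ r s₀ s (T : Vec (Vec ℤ (suc (suc (suc n)))) m) →
                  let T′ = map tail T; φ′ = λ X → φ (zipWith _∷_ (map head T) X) in
                  expand₂ φ (r₀ ∷ r) (s₀ ∷ s) T ≡ r₀ * expand₁ φ s T′ + - (s₀ * expand₁ φ r T′) + expand₂ φ′ r s T′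
  expand₂-split {n = n} {m = m} φ r₀ r s₀ (s₁ ∷ s) T = begin
      1ℤ * r₀ * expand₁ φ (s₁ ∷ s) (minor zero T) + ∑ (λ j → sign (suc j) * lookup r j * inner j)
    ≡⟨ cong₂ _+_ (cong (λ X → 1ℤ * r₀ * expand₁ φ (s₁ ∷ s) X) (minor-zero T)) (∑-cong column) ⟩
      1ℤ * r₀ * A + ∑ (λ j → - (s₀ * term j) + sign j * lookup r j * rest j)
    ≡⟨ cong (1ℤ * r₀ * A +_) (∑-distrib-+ (λ j → - (s₀ * term j)) (λ j → sign j * lookup r j * rest j)) ⟩
      1ℤ * r₀ * A + (∑ (λ j → - (s₀ * term j)) + expand₂ φ′ r (s₁ ∷ s) T′)
    ≡⟨ cong (λ z → 1ℤ * r₀ * A + (z + expand₂ φ′ r (s₁ ∷ s) T′))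
            (trans (∑-neg (λ j → s₀ * term j)) (cong -_ (∑-*ˡ s₀ term))) ⟩
      1ℤ * r₀ * A + (- (s₀ * expand₁ φ r T′) + expand₂ φ′ r (s₁ ∷ s) T′)
    ≡⟨ reassoc r₀ A s₀ (expand₁ φ r T′) (expand₂ φ′ r (s₁ ∷ s) T′) ⟩
      r₀ * A + - (s₀ * expand₁ φ r T′) + expand₂ φ′ r (s₁ ∷ s) T′ ∎
    where
    T′ : Vec (Vec ℤ (suc (suc n))) m
    T′ = map tail T
    φ′ : Vec (Vec ℤ n) m → ℤ
    φ′ X = φ (zipWith _∷_ (map head T) X)
    A : ℤ
    A = expand₁ φ (s₁ ∷ s) T′
    term rest : Fin (suc (suc n)) → ℤ
    term j = sign j * lookup r j * φ (minor j T′)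
    rest j = expand₁ φ′ (removeAt (s₁ ∷ s) j) (minor j T′)
    inner : Fin (suc (suc n)) → ℤ
    inner j = expand₁ φ (removeAt (s₀ ∷ s₁ ∷ s) (suc j)) (minor (suc j) T)
    reassoc : ∀ a b c d e → 1ℤ * a * b + (- (c * d) + e) ≡ a * b + - (c * d) + e
    reassoc = solve-∀
    negˡ : ∀ a b c → - a * b * c ≡ - (a * b * c)
    negˡ = solve-∀
    distribute : ∀ sj rj s₀ P q → - sj * rj * (1ℤ * s₀ * P + - q) ≡ - (s₀ * (sj * rj * P)) + sj * rj * q
    distribute = solve-∀
    inner-split : ∀ j → inner j ≡ 1ℤ * s₀ * φ (minor j T′) + - rest j
    inner-split j = cong₂ (λ a b → 1ℤ * s₀ * φ a + b) (minor-zero-suc j T)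
      (trans (∑-cong (λ k → trans (cong (λ X → sign (suc k) * lookup (removeAt (s₁ ∷ s) j) k * φ X) (minor-suc-suc j k T))
                                  (negˡ (sign k) (lookup (removeAt (s₁ ∷ s) j) k) _)))
             (∑-neg (λ k → sign k * lookup (removeAt (s₁ ∷ s) j) k * φ′ (minor k (minor j T′)))))
    column : ∀ j → sign (suc j) * lookup r j * inner j ≡ - (s₀ * term j) + sign j * lookup r j * rest j
    column j = trans (cong (- sign j * lookup r j *_) (inner-split j)) (distribute (sign j) (lookup r j) s₀ _ (rest j))

  expand₂-antisym : ∀ (φ : Vec (Vec ℤ n) m → ℤ) r s T → expand₂ φ r s T + expand₂ φ s r T ≡ 0ℤ
  expand₂-antisym {ℕ.zero} φ (r₀ ∷ r₁ ∷ []) (s₀ ∷ s₁ ∷ []) T =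
    trans (cong₂ (λ a b → (1ℤ * r₀ * (1ℤ * s₁ * φ a + 0ℤ) + (- 1ℤ * r₁ * (1ℤ * s₀ * φ b + 0ℤ) + 0ℤ))
                        + (1ℤ * s₀ * (1ℤ * r₁ * φ a + 0ℤ) + (- 1ℤ * s₁ * (1ℤ * r₀ * φ b + 0ℤ) + 0ℤ)))
                 (empty (minor zero (minor zero T))) (empty (minor zero (minor (suc zero) T))))
          (cancel r₀ r₁ s₀ s₁ (φ (replicate _ [])))
    where
    empty : (X : Vec (Vec ℤ 0) m) → X ≡ replicate m []
    empty [] = refl
    empty ([] ∷ X) = cong ([] ∷_) (empty X)
    cancel : ∀ r₀ r₁ s₀ s₁ P → (1ℤ * r₀ * (1ℤ * s₁ * P + 0ℤ) + (- 1ℤ * r₁ * (1ℤ * s₀ * P + 0ℤ) + 0ℤ))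
                              + (1ℤ * s₀ * (1ℤ * r₁ * P + 0ℤ) + (- 1ℤ * s₁ * (1ℤ * r₀ * P + 0ℤ) + 0ℤ)) ≡ 0ℤ
    cancel = solve-∀
  expand₂-antisym {n = suc n} {m = m} φ (r₀ ∷ r) (s₀ ∷ s) T = begin
      expand₂ φ (r₀ ∷ r) (s₀ ∷ s) T + expand₂ φ (s₀ ∷ s) (r₀ ∷ r) T
    ≡⟨ cong₂ _+_ (expand₂-split φ r₀ r s₀ s T) (expand₂-split φ s₀ s r₀ r T) ⟩
      (r₀ * A + - (s₀ * B) + expand₂ φ′ r s T′) + (s₀ * B + - (r₀ * A) + expand₂ φ′ s r T′)
    ≡⟨ cancel (r₀ * A) (s₀ * B) _ _ ⟩
      expand₂ φ′ r s T′ + expand₂ φ′ s r T′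
    ≡⟨ expand₂-antisym φ′ r s T′ ⟩
      0ℤ ∎
    where
    T′ : Vec (Vec ℤ (suc (suc n))) m
    T′ = map tail T
    φ′ : Vec (Vec ℤ n) m → ℤ
    φ′ X = φ (zipWith _∷_ (map head T) X)
    A B : ℤ
    A = expand₁ φ s T′
    B = expand₁ φ r T′
    cancel : ∀ a b x y → (a + - b + x) + (b + - a + y) ≡ x + y
    cancel = solve-∀

  det-repeatedRow : ∀ (t : Vec ℤ (suc (suc n))) T → det (t ∷ t ∷ T) ≡ 0ℤ
  det-repeatedRow t T = x+x≡0⇒x≡0 _ (expand₂-antisym det t t T)
    where
    x+x≡0⇒x≡0 : ∀ x → x + x ≡ 0ℤ → x ≡ 0ℤ
    x+x≡0⇒x≡0 (ℤ.+ ℕ.zero) _ = refl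
    x+x≡0⇒x≡0 (ℤ.+ suc _) ()
    x+x≡0⇒x≡0 ℤ.-[1+ _ ] ()

  det-rowDifference : ∀ (r t : Vec ℤ (suc n)) T → det (zipWith _-_ r t ∷ T) ≡ det (r ∷ T) - det (t ∷ T)
  det-rowDifference r t T = begin
      ∑ (λ j → sign j * lookup (zipWith _-_ r t) j * det (minor j T))
    ≡⟨ ∑-cong (λ j → trans (cong (λ x → sign j * x * det (minor j T)) (lookup-zipWith _-_ j r t))
                           (distrib (sign j) (lookup r j) (lookup t j) (det (minor j T)))) ⟩
      ∑ (λ j → sign j * lookup r j * det (minor j T) + - (sign j * lookup t j * det (minor j T)))
    ≡⟨ ∑-distrib-+ (λ j → sign j * lookup r j * det (minor j T)) (λ j → - (sign j * lookup t j * det (minor j T))) ⟩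
      det (r ∷ T) + ∑ (λ j → - (sign j * lookup t j * det (minor j T)))
    ≡⟨ cong (det (r ∷ T) +_) (∑-neg (λ j → sign j * lookup t j * det (minor j T))) ⟩
      det (r ∷ T) - det (t ∷ T) ∎
    where
    distrib : ∀ s a b d → s * (a - b) * d ≡ s * a * d + - (s * b * d)
    distrib = solve-∀

  differences : Vec (Vec ℤ n) (suc m) → Vec (Vec ℤ n) (suc m)
  differences (r ∷ []) = r ∷ []
  differences (r ∷ t ∷ T) = zipWith _-_ r t ∷ differences (t ∷ T)

  minor-differences : ∀ j (M : Vec (Vec ℤ (suc n)) (suc m)) → minor j (differences M) ≡ differences (minor j M)
  minor-differences j (r ∷ []) = refl
  minor-differences j (r ∷ t ∷ T) = cong₂ _∷_ (removeAt-zipWith r t j) (minor-differences j (t ∷ T))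
    where
    removeAt-zipWith : ∀ {n} (a b : Vec ℤ (suc n)) j → removeAt (zipWith _-_ a b) j ≡ zipWith _-_ (removeAt a j) (removeAt b j)
    removeAt-zipWith (x ∷ a) (y ∷ b) zero = refl
    removeAt-zipWith (x ∷ a ∷ as) (y ∷ b ∷ bs) (suc j) = cong (x - y ∷_) (removeAt-zipWith (a ∷ as) (b ∷ bs) j)

  mutual
    det-differences : (M : Vec (Vec ℤ (suc m)) (suc m)) → det (differences M) ≡ det M
    det-differences {ℕ.zero} (r ∷ []) = refl
    det-differences {suc m} (r ∷ t ∷ T) = begin
        det (zipWith _-_ r t ∷ differences (t ∷ T))  ≡⟨ det-differences-below (zipWith _-_ r t) (t ∷ T) ⟩
        det (zipWith _-_ r t ∷ t ∷ T)                ≡⟨ det-rowDifference r t (t ∷ T) ⟩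
        det (r ∷ t ∷ T) - det (t ∷ t ∷ T)            ≡⟨ cong (λ x → det (r ∷ t ∷ T) - x) (det-repeatedRow t T) ⟩
        det (r ∷ t ∷ T) - 0ℤ                         ≡⟨ +-identityʳ _ ⟩
        det (r ∷ t ∷ T)                              ∎

    det-differences-below : ∀ (r : Vec ℤ (suc (suc m))) T → det (r ∷ differences T) ≡ det (r ∷ T)
    det-differences-below r T = ∑-cong (λ j → cong (λ x → sign j * lookup r j * x)
                                  (trans (cong det (minor-differences j T)) (det-differences (minor j T))))

  -- e_{p+1} − e_p, the difference u − v of a move from u to v at p
  adjacentDiff : Fin n → Vec ℤ (suc n)
  adjacentDiff {suc n} zero = -1ℤ ∷ 1ℤ ∷ replicate n 0ℤ
  adjacentDiff {suc n} (suc p) = 0ℤ ∷ adjacentDiff p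

  expand-adjacentDiff : ∀ (p : Fin n) (g : Fin (suc n) → ℤ) →
                        ∑ (λ j → sign j * lookup (adjacentDiff p) j * g j) ≡ - (sign (inject₁ p) * (g (inject₁ p) + g (suc p)))
  expand-adjacentDiff {suc n} zero g =
    trans (cong (λ z → 1ℤ * -1ℤ * g zero + (- 1ℤ * 1ℤ * g (suc zero) + z))
                (∑-zero _ (λ j → trans (cong (λ z → sign (suc (suc j)) * z * g (suc (suc j))) (lookup-replicate j 0ℤ))
                                       (trans (cong (_* g (suc (suc j))) (*-zeroʳ (sign (suc (suc j))))) (*-zeroˡ (g (suc (suc j))))))))
          (collect (g zero) (g (suc zero)))
    where
    collect : ∀ a b → 1ℤ * -1ℤ * a + (- 1ℤ * 1ℤ * b + 0ℤ) ≡ - (1ℤ * (a + b))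
    collect = solve-∀
  expand-adjacentDiff {suc n} (suc p) g =
    trans (cong (1ℤ * 0ℤ * g zero +_)
            (trans (∑-cong (λ j → negˡ (sign j) (lookup (adjacentDiff p) j) (g (suc j))))
                   (trans (∑-neg (λ j → sign j * lookup (adjacentDiff p) j * g (suc j))) (cong -_ (expand-adjacentDiff p (g ∘ suc))))))
          (collect (sign (inject₁ p)) (g (suc (inject₁ p))) (g (suc (suc p))))
    where
    negˡ : ∀ a b c → - a * b * c ≡ - (a * b * c)
    negˡ = solve-∀
    collect : ∀ s a b → 1ℤ * 0ℤ * g zero + - - (s * (a + b)) ≡ - (- s * (a + b))
    collect = solve-∀

  mergeColumns : Fin n → Vec ℤ (suc n) → Vec ℤ n
  mergeColumns zero (a ∷ b ∷ xs) = (b + a) ∷ xs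
  mergeColumns (suc p) (a ∷ xs) = a ∷ mergeColumns p xs

  data SplitAt : Fin n → Vec ℤ n → Vec ℤ n → Vec ℤ n → Set where
    here : ∀ {x y} {xs : Vec ℤ n} → SplitAt zero (x ∷ xs) (y ∷ xs) ((x + y) ∷ xs)
    there : ∀ {q x} {xs ys zs : Vec ℤ n} → SplitAt q xs ys zs → SplitAt (suc q) (x ∷ xs) (x ∷ ys) (x ∷ zs)

  data SplitRowsAt (q : Fin n) : Vec (Vec ℤ n) m → Vec (Vec ℤ n) m → Vec (Vec ℤ n) m → Set where
    [] : SplitRowsAt q [] [] []
    _∷_ : ∀ {a b c} {As Bs Cs : Vec (Vec ℤ n) m} →
          SplitAt q a b c → SplitRowsAt q As Bs Cs → SplitRowsAt q (a ∷ As) (b ∷ Bs) (c ∷ Cs)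

  SplitAt-at : ∀ {q} {a b c : Vec ℤ n} → SplitAt q a b c → lookup c q ≡ lookup a q + lookup b q
  SplitAt-at here = refl
  SplitAt-at (there s) = SplitAt-at s

  SplitAt-off : ∀ {q} {a b c : Vec ℤ n} → SplitAt q a b c → ∀ l → l ≢ q → lookup a l ≡ lookup c l × lookup b l ≡ lookup c l
  SplitAt-off here zero l≢q = ⊥-elim (l≢q refl)
  SplitAt-off here (suc l) _ = refl , refl
  SplitAt-off (there s) zero _ = refl , refl
  SplitAt-off (there s) (suc l) l≢q = SplitAt-off s l (l≢q ∘ cong suc)

  SplitAt-removeAt : ∀ {q} {a b c : Vec ℤ (suc n)} → SplitAt q a b c → removeAt a q ≡ removeAt c q × removeAt b q ≡ removeAt c q
  SplitAt-removeAt here = refl , refl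
  SplitAt-removeAt (there {xs = _ ∷ _} {_ ∷ _} {_ ∷ _} s) =
    cong (_ ∷_) (proj₁ (SplitAt-removeAt s)) , cong (_ ∷_) (proj₂ (SplitAt-removeAt s))

  SplitAt-removeAt-other : ∀ {q} {a b c : Vec ℤ (suc n)} → SplitAt q a b c → ∀ l (l≢q : l ≢ q) →
                           SplitAt (punchOut l≢q) (removeAt a l) (removeAt b l) (removeAt c l)
  SplitAt-removeAt-other here zero l≢q = ⊥-elim (l≢q refl)
  SplitAt-removeAt-other (here {xs = _ ∷ _}) (suc l) _ = here
  SplitAt-removeAt-other (there s) zero _ = s
  SplitAt-removeAt-other (there {xs = _ ∷ _} {_ ∷ _} {_ ∷ _} s) (suc l) l≢q = there (SplitAt-removeAt-other s l (l≢q ∘ cong suc))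

  SplitRowsAt-minor : ∀ {q} {A B C : Vec (Vec ℤ (suc n)) m} → SplitRowsAt q A B C → minor q A ≡ minor q C × minor q B ≡ minor q C
  SplitRowsAt-minor [] = refl , refl
  SplitRowsAt-minor (s ∷ ss) = cong₂ _∷_ (proj₁ (SplitAt-removeAt s)) (proj₁ (SplitRowsAt-minor ss)) ,
                               cong₂ _∷_ (proj₂ (SplitAt-removeAt s)) (proj₂ (SplitRowsAt-minor ss))

  SplitRowsAt-minor-other : ∀ {q} {A B C : Vec (Vec ℤ (suc n)) m} → SplitRowsAt q A B C → ∀ l (l≢q : l ≢ q) →
                            SplitRowsAt (punchOut l≢q) (minor l A) (minor l B) (minor l C)
  SplitRowsAt-minor-other [] l l≢q = []
  SplitRowsAt-minor-other (s ∷ ss) l l≢q = SplitAt-removeAt-other s l l≢q ∷ SplitRowsAt-minor-other ss l l≢q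

  det-additive-column : ∀ {q : Fin (suc n)} {A B C : Vec (Vec ℤ (suc n)) (suc n)} → SplitRowsAt q A B C → det C ≡ det A + det B
  det-additive-column {ℕ.zero} {zero} (here {x = x} {y} {[]} ∷ []) = distrib x y
    where
    distrib : ∀ x y → 1ℤ * (x + y) * 1ℤ + 0ℤ ≡ (1ℤ * x * 1ℤ + 0ℤ) + (1ℤ * y * 1ℤ + 0ℤ)
    distrib = solve-∀
  det-additive-column {suc n} {q} {a ∷ As} {b ∷ Bs} {c ∷ Cs} (s ∷ ss) =
    trans (∑-cong term) (∑-distrib-+ (λ l → sign l * lookup a l * det (minor l As)) (λ l → sign l * lookup b l * det (minor l Bs)))
    where
    distribˡ : ∀ s x y D → s * (x + y) * D ≡ s * x * D + s * y * D
    distribˡ = solve-∀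
    distribʳ : ∀ s x DA DB → s * x * (DA + DB) ≡ s * x * DA + s * x * DB
    distribʳ = solve-∀
    term : ∀ l → sign l * lookup c l * det (minor l Cs) ≡ sign l * lookup a l * det (minor l As) + sign l * lookup b l * det (minor l Bs)
    term l with l ≟ q
    ... | yes refl = trans (cong (λ z → sign l * z * det (minor l Cs)) (SplitAt-at s))
                     (trans (distribˡ (sign l) (lookup a l) (lookup b l) (det (minor l Cs)))
                            (cong₂ (λ X Y → sign l * lookup a l * det X + sign l * lookup b l * det Y)
                                   (sym (proj₁ (SplitRowsAt-minor ss))) (sym (proj₂ (SplitRowsAt-minor ss)))))
    ... | no l≢q = trans (cong (sign l * lookup c l *_) (det-additive-column (SplitRowsAt-minor-other ss l l≢q)))
                   (trans (distribʳ (sign l) (lookup c l) (det (minor l As)) (det (minor l Bs)))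
                          (cong₂ (λ X Y → sign l * X * det (minor l As) + sign l * Y * det (minor l Bs))
                                 (sym (proj₁ (SplitAt-off s l l≢q))) (sym (proj₂ (SplitAt-off s l l≢q)))))

  SplitRowsAt-mergeColumns : ∀ (p : Fin (suc n)) (R : Vec (Vec ℤ (suc (suc n))) m) →
                             SplitRowsAt p (minor (inject₁ p) R) (minor (suc p) R) (map (mergeColumns p) R)
  SplitRowsAt-mergeColumns p [] = []
  SplitRowsAt-mergeColumns p (row ∷ R) = split p row ∷ SplitRowsAt-mergeColumns p R
    where
    split : ∀ {n} (p : Fin (suc n)) (row : Vec ℤ (suc (suc n))) →
            SplitAt p (removeAt row (inject₁ p)) (removeAt row (suc p)) (mergeColumns p row)
    split zero (a ∷ b ∷ xs) = here
    split (suc p) (a ∷ b ∷ c ∷ xs) = there (split p (b ∷ c ∷ xs))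

  det-adjacentDiff : ∀ (p : Fin (suc n)) (R : Vec (Vec ℤ (suc (suc n))) (suc n)) →
                     det (adjacentDiff p ∷ R) ≡ - (sign (inject₁ p) * det (map (mergeColumns p) R))
  det-adjacentDiff p R = trans (expand-adjacentDiff p (λ j → det (minor j R)))
                               (cong (λ z → - (sign (inject₁ p) * z)) (sym (det-additive-column (SplitRowsAt-mergeColumns p R))))

  mergeColumns-adjacentDiff : ∀ (p q : Fin (suc n)) (p≢q : p ≢ q) → mergeColumns p (adjacentDiff q) ≡ adjacentDiff (punchOut p≢q)
  mergeColumns-adjacentDiff zero zero p≢q = ⊥-elim (p≢q refl)
  mergeColumns-adjacentDiff {suc n} zero (suc zero) _ = refl
  mergeColumns-adjacentDiff {suc n} zero (suc (suc q)) _ = refl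
  mergeColumns-adjacentDiff {suc n} (suc zero) zero _ = refl
  mergeColumns-adjacentDiff {suc n} (suc (suc p)) zero _ = cong (λ z → -1ℤ ∷ 1ℤ ∷ z) (mergeColumns-zero p)
    where
    mergeColumns-zero : ∀ {n} (p : Fin n) → mergeColumns p (replicate (suc n) 0ℤ) ≡ replicate n 0ℤ
    mergeColumns-zero zero = refl
    mergeColumns-zero (suc p) = cong (0ℤ ∷_) (mergeColumns-zero p)
  mergeColumns-adjacentDiff {suc n} (suc p) (suc q) p≢q = cong (0ℤ ∷_) (mergeColumns-adjacentDiff p q (p≢q ∘ cong suc))

  sumᵥ : Vec ℤ n → ℤ
  sumᵥ = foldr (λ _ → ℤ) _+_ 0ℤ

  sumᵥ-mergeColumns : ∀ (p : Fin n) (u : Vec ℤ (suc n)) → sumᵥ (mergeColumns p u) ≡ sumᵥ u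
  sumᵥ-mergeColumns zero (a ∷ b ∷ xs) = swap a b (sumᵥ xs)
    where
    swap : ∀ a b s → (b + a) + s ≡ a + (b + s)
    swap = solve-∀
  sumᵥ-mergeColumns (suc p) (a ∷ xs) = cong (a +_) (sumᵥ-mergeColumns p xs)

  diffMatrix : ∀ {k} → Vec (Fin n) k → Vec ℤ (suc n) → Vec (Vec ℤ (suc n)) (suc k)
  diffMatrix [] u = u ∷ []
  diffMatrix (p ∷ ps) u = adjacentDiff p ∷ diffMatrix ps u

  punchOutAll : ∀ {k} (p : Fin (suc n)) (ps : Vec (Fin (suc n)) k) → All (p ≢_) ps → Vec (Fin n) k
  punchOutAll p [] [] = []
  punchOutAll p (q ∷ qs) (p≢q ∷ p≢qs) = punchOut p≢q ∷ punchOutAll p qs p≢qs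

  mergeColumns-diffMatrix : ∀ {k} (p : Fin (suc n)) (ps : Vec (Fin (suc n)) k) (p∉ps : All (p ≢_) ps) u →
                            map (mergeColumns p) (diffMatrix ps u) ≡ diffMatrix (punchOutAll p ps p∉ps) (mergeColumns p u)
  mergeColumns-diffMatrix p [] [] u = refl
  mergeColumns-diffMatrix p (q ∷ qs) (p≢q ∷ p∉qs) u =
    cong₂ _∷_ (mergeColumns-adjacentDiff p q p≢q) (mergeColumns-diffMatrix p qs p∉qs u)

  punchOutAll-unique : ∀ {k} (p : Fin (suc n)) (ps : Vec (Fin (suc n)) k) (p∉ps : All (p ≢_) ps) →
                       Unique ps → Unique (punchOutAll p ps p∉ps)
  punchOutAll-unique p [] [] [] = []
  punchOutAll-unique p (q ∷ qs) (p≢q ∷ p∉qs) (q∉qs ∷ u) = distinct qs p∉qs q∉qs ∷ punchOutAll-unique p qs p∉qs u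
    where
    distinct : ∀ {k} (rs : Vec (Fin _) k) (p∉rs : All (p ≢_) rs) → All (q ≢_) rs → All (punchOut p≢q ≢_) (punchOutAll p rs p∉rs)
    distinct [] [] [] = []
    distinct (r ∷ rs) (p≢r ∷ p∉rs) (q≢r ∷ q∉rs) = (q≢r ∘ punchOut-injective p≢q p≢r) ∷ distinct rs p∉rs q∉rs

  sign-±1 : (j : Fin n) → sign j ≡ 1ℤ ⊎ sign j ≡ -1ℤ
  sign-±1 zero = inj₁ refl
  sign-±1 (suc j) with sign-±1 j
  ... | inj₁ e = inj₂ (cong -_ e)
  ... | inj₂ e = inj₁ (cong -_ e)

  -- Merging the two columns touched by the first row reduces to the same
  -- shape one size smaller, without changing the total of the last row.
  det-diffMatrix : (ps : Vec (Fin m) m) → Unique ps → (u : Vec ℤ (suc m)) →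
                   det (diffMatrix ps u) ≡ sumᵥ u ⊎ det (diffMatrix ps u) ≡ - sumᵥ u
  det-diffMatrix {ℕ.zero} [] [] (u ∷ []) = inj₁ (unit u)
    where
    unit : ∀ u → 1ℤ * u * 1ℤ + 0ℤ ≡ u + 0ℤ
    unit = solve-∀
  det-diffMatrix {suc m} (p ∷ ps) (p∉ps ∷ u-ps) u =
    conclude (det-diffMatrix (punchOutAll p ps p∉ps) (punchOutAll-unique p ps p∉ps u-ps) (mergeColumns p u)) (sign-±1 (inject₁ p))
    where
    S D′ : ℤ
    S = sumᵥ u
    D′ = det (diffMatrix (punchOutAll p ps p∉ps) (mergeColumns p u))
    reduce : det (diffMatrix (p ∷ ps) u) ≡ - (sign (inject₁ p) * D′)
    reduce = trans (det-adjacentDiff p (diffMatrix ps u)) (cong (λ M → - (sign (inject₁ p) * det M)) (mergeColumns-diffMatrix p ps p∉ps u))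
    total : sumᵥ (mergeColumns p u) ≡ S
    total = sumᵥ-mergeColumns p u
    neg-one : ∀ x → - (1ℤ * x) ≡ - x
    neg-one = solve-∀
    neg-minus-one : ∀ x → - (-1ℤ * x) ≡ x
    neg-minus-one = solve-∀
    conclude : D′ ≡ sumᵥ (mergeColumns p u) ⊎ D′ ≡ - sumᵥ (mergeColumns p u) →
               sign (inject₁ p) ≡ 1ℤ ⊎ sign (inject₁ p) ≡ -1ℤ →
               det (diffMatrix (p ∷ ps) u) ≡ S ⊎ det (diffMatrix (p ∷ ps) u) ≡ - S
    conclude (inj₁ e) (inj₁ s) = inj₂ (trans reduce (trans (cong₂ (λ a b → - (a * b)) s (trans e total)) (neg-one S)))
    conclude (inj₁ e) (inj₂ s) = inj₁ (trans reduce (trans (cong₂ (λ a b → - (a * b)) s (trans e total)) (neg-minus-one S)))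
    conclude (inj₂ e) (inj₁ s) =
      inj₁ (trans reduce (trans (cong₂ (λ a b → - (a * b)) s (trans e (cong -_ total))) (trans (neg-one (- S)) (neg-involutive S))))
    conclude (inj₂ e) (inj₂ s) = inj₂ (trans reduce (trans (cong₂ (λ a b → - (a * b)) s (trans e (cong -_ total))) (neg-minus-one (- S))))


open import Data.Bool using (Bool; true; false; T; _∧_; _∨_; if_then_else_)
open import Data.Empty using (⊥; ⊥-elim)
open import Data.Fin as Fin using (Fin; zero; suc; toℕ; inject₁; fromℕ; fromℕ<)
import Data.Fin.Properties as Fin
open import Data.Integer as ℤ using (ℤ)
import Data.Integer.Properties as ℤ
open import Data.List as L using (List; []; _∷_; _++_; length; upTo; concatMap)
import Data.List.Properties as L
open import Data.List.Membership.Propositional using (_∈_)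
import Data.List.Membership.Propositional.Properties as ∈
open import Data.List.Relation.Binary.Permutation.Propositional
  using (_↭_; ↭-refl; ↭-sym; ↭-trans; ↭-reflexive; ↭⇒↭ₛ; module PermutationReasoning)
open import Data.List.Relation.Binary.Permutation.Propositional.Properties
  using (++⁺ˡ; shifts; ∈-resp-↭; drop-∷; ↭-empty-inv; ¬x∷xs↭[]; All-resp-↭; ↭-reverse; ↭-length)
import Data.List.Relation.Binary.Permutation.Setoid.Properties as Permutationₛ
open import Data.List.Relation.Unary.All as All using (All; []; _∷_)
open import Data.List.Relation.Unary.AllPairs as AllPairs using ([]; _∷_)
open import Data.List.Relation.Unary.Any as Any using (here; there)
import Data.List.Relation.Unary.Any.Properties as Any
open import Data.List.Relation.Unary.Linked as Linked using (Linked; []; [-]; _∷_)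
open import Data.List.Relation.Unary.Linked.Properties using (Linked⇒AllPairs)
open import Data.List.Relation.Unary.Unique.Propositional using (Unique)
import Data.List.Relation.Unary.Unique.Propositional.Properties as Unique
open import Data.Nat
open import Data.Nat.ListAction using (sum)
open import Data.Nat.Properties
open import Data.Nat.Tactic.RingSolver using (solve-∀)
open import Data.Product as Product using (Σ; ∃; _×_; _,_; proj₁; proj₂)
open import Data.Sum using (_⊎_; inj₁; inj₂)
open import Data.Vec as V using (Vec; []; _∷_; _∷ʳ_; toList; tabulate; lookup)
import Data.Vec.Properties as V
open import Data.Vec.Membership.Propositional renaming (_∈_ to _∈ᵥ_)
import Data.Vec.Membership.Propositional.Properties as ∈ᵥ
open import Data.Vec.Relation.Binary.Equality.Cast using (cast-is-id)
open import Data.Vec.Relation.Binary.Pointwise.Inductive as Pointwise using (Pointwise; []; _∷_; Pointwise-≡⇒≡)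
import Data.Vec.Relation.Unary.All.Properties as VecAll
open import Data.Vec.Relation.Unary.AllPairs using ([]; _∷_)
open import Data.Vec.Relation.Unary.Any using (here; there)
import Data.Vec.Relation.Unary.Unique.Propositional as Vecᵘ
import Data.Vec.Relation.Unary.Unique.Propositional.Properties as Vecᵘ
open import Function using (_∘_; flip)
open import Relation.Nullary using (¬_; Dec; yes; no)
open import Relation.Binary.Definitions using (Transitive; Irreflexive; tri<; tri≈; tri>)
open import Relation.Binary.PropositionalEquality hiding ([_])
open import Algebra.Properties.CommutativeSemigroup +-commutativeSemigroup using (interchange; x∙yz≈y∙xz)

private variable
  A B C : Set
  k n : ℕ
  R : A → A → B → Set

-- Vec.last does not compute on x ∷ y ∷ ys; this one does.
last′ : Vec A (suc k) → A
last′ (x ∷ []) = x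
last′ (x ∷ y ∷ xs) = last′ (y ∷ xs)

last′-∈ : (xs : Vec A (suc k)) → last′ xs ∈ toList xs
last′-∈ (x ∷ []) = here refl
last′-∈ (x ∷ y ∷ xs) = there (last′-∈ (y ∷ xs))

last′-∷ʳ : (xs : Vec A k) (x : A) → last′ (xs ∷ʳ x) ≡ x
last′-∷ʳ [] x = refl
last′-∷ʳ (y ∷ []) x = refl
last′-∷ʳ (y ∷ z ∷ xs) x = last′-∷ʳ (z ∷ xs) x

last′-reverse : (xs : Vec A (suc k)) → last′ (V.reverse xs) ≡ V.head xs
last′-reverse (x ∷ xs) = trans (cong last′ (V.reverse-∷ x xs)) (last′-∷ʳ (V.reverse xs) x)

head-reverse : (xs : Vec A (suc k)) → V.head (V.reverse xs) ≡ last′ xs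
head-reverse xs = sym (trans (cong last′ (sym (V.reverse-involutive xs))) (last′-reverse (V.reverse xs)))

last′-tabulate : (f : Fin (suc k) → A) → last′ (tabulate f) ≡ f (fromℕ k)
last′-tabulate {k = zero} f = refl
last′-tabulate {k = suc k} f = last′-tabulate (f ∘ suc)

tabulate-∷ʳ : (f : Fin (suc k) → A) → tabulate f ≡ tabulate (f ∘ inject₁) ∷ʳ f (fromℕ k)
tabulate-∷ʳ {k = zero} f = refl
tabulate-∷ʳ {k = suc k} f = cong (f zero ∷_) (tabulate-∷ʳ (f ∘ suc))

lookup-ext : (u v : Vec A n) → (∀ j → lookup u j ≡ lookup v j) → u ≡ v
lookup-ext u v same = trans (sym (V.tabulate∘lookup u)) (trans (V.tabulate-cong same) (V.tabulate∘lookup v))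

toList-injective : (u v : Vec A k) → toList u ≡ toList v → u ≡ v
toList-injective u v eq = trans (sym (cast-is-id refl u)) (V.toList-injective refl u v eq)

toList-reverse-↭ : (xs : Vec A k) → toList (V.reverse xs) ↭ toList xs
toList-reverse-↭ xs = subst (_↭ toList xs) (sym (V.toList-reverse xs)) (↭-reverse (toList xs))

Unique-resp-↭ : ∀ {xs ys : List A} → xs ↭ ys → Unique xs → Unique ys
Unique-resp-↭ xs↭ys = Permutationₛ.Unique-resp-↭ (setoid _) (↭⇒↭ₛ xs↭ys)

Unique-toList⁺ : ∀ {xs : Vec A k} → Vecᵘ.Unique xs → Unique (toList xs)
Unique-toList⁺ [] = []
Unique-toList⁺ (x∉ ∷ distinct) = VecAll.toList⁺ x∉ ∷ Unique-toList⁺ distinct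

Unique-toList⁻ : ∀ {xs : Vec A k} → Unique (toList xs) → Vecᵘ.Unique xs
Unique-toList⁻ {xs = []} [] = []
Unique-toList⁻ {xs = x ∷ xs} (x∉ ∷ distinct) = VecAll.toList⁻ x∉ ∷ Unique-toList⁻ distinct

Unique-reverse : ∀ {xs : Vec A k} → Vecᵘ.Unique xs → Vecᵘ.Unique (V.reverse xs)
Unique-reverse {xs = xs} distinct = Unique-toList⁻ (Unique-resp-↭ (↭-sym (toList-reverse-↭ xs)) (Unique-toList⁺ distinct))

Linked-↭⇒≡ : {_<_ : A → A → Set} → Transitive _<_ → Irreflexive _≡_ _<_ →
              ∀ {xs ys} → Linked _<_ xs → Linked _<_ ys → xs ↭ ys → xs ≡ ys
Linked-↭⇒≡ <-trans <-irrefl {[]} _ _ xs↭ys = sym (↭-empty-inv (↭-sym xs↭ys))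
Linked-↭⇒≡ <-trans <-irrefl {x ∷ xs} {[]} _ _ xs↭ys = ⊥-elim (¬x∷xs↭[] xs↭ys)
Linked-↭⇒≡ {_<_ = _<_} <-trans <-irrefl {x ∷ xs} {y ∷ ys} x∷xs↑ y∷ys↑ xs↭ys =
  cong₂ _∷_ x≡y (Linked-↭⇒≡ <-trans <-irrefl (Linked.tail x∷xs↑) (Linked.tail y∷ys↑)
                                                (drop-∷ (subst (λ t → t ∷ xs ↭ y ∷ ys) x≡y xs↭ys)))
  where
  x≡y : x ≡ y
  x≡y with ∈-resp-↭ xs↭ys (here refl) | ∈-resp-↭ (↭-sym xs↭ys) (here refl)
  ... | here x≡y | _ = x≡y
  ... | there _ | here y≡x = sym y≡x
  ... | there x∈ys | there y∈xs =
    ⊥-elim (<-irrefl refl (<-trans (All.lookup (AllPairs.head (Linked⇒AllPairs <-trans x∷xs↑)) y∈xs)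
                                   (All.lookup (AllPairs.head (Linked⇒AllPairs <-trans y∷ys↑)) x∈ys)))

nth-++ˡ : ∀ xs ys j → j < length xs → nth (xs ++ ys) j ≡ nth xs j
nth-++ˡ (x ∷ xs) ys zero _ = refl
nth-++ˡ (x ∷ xs) ys (suc j) (s≤s j<n) = nth-++ˡ xs ys j j<n

nth-++ʳ : ∀ xs ys j → nth (xs ++ ys) (length xs + j) ≡ nth ys j
nth-++ʳ [] ys j = refl
nth-++ʳ (x ∷ xs) ys j = nth-++ʳ xs ys j

nth-lookup : ∀ (xs : List ℕ) (j : Fin (length xs)) → nth xs (toℕ j) ≡ L.lookup xs j
nth-lookup (x ∷ xs) zero = refl
nth-lookup (x ∷ xs) (suc j) = nth-lookup xs j

nth-∈ : ∀ (xs : List ℕ) j → j < length xs → nth xs j ∈ xs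
nth-∈ (x ∷ xs) zero _ = here refl
nth-∈ (x ∷ xs) (suc j) (s≤s j<n) = there (nth-∈ xs j j<n)

nth-injective : ∀ {xs : List ℕ} → Unique xs → ∀ {j k} → j < length xs → k < length xs → nth xs j ≡ nth xs k → j ≡ k
nth-injective {x ∷ xs} _ {zero} {zero} _ _ _ = refl
nth-injective {x ∷ xs} (x∉ ∷ _) {zero} {suc k} _ (s≤s k<n) x≡ = ⊥-elim (All.lookup x∉ (nth-∈ xs k k<n) x≡)
nth-injective {x ∷ xs} (x∉ ∷ _) {suc j} {zero} (s≤s j<n) _ ≡x = ⊥-elim (All.lookup x∉ (nth-∈ xs j j<n) (sym ≡x))
nth-injective {x ∷ xs} (_ ∷ distinct) {suc j} {suc k} (s≤s j<n) (s≤s k<n) eq = cong suc (nth-injective distinct j<n k<n eq)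

nth-beyond : ∀ (xs : List ℕ) j → length xs ≤ j → nth xs j ≡ 0
nth-beyond [] j _ = refl
nth-beyond (x ∷ xs) (suc j) (s≤s n≤j) = nth-beyond xs j n≤j

nth-ext : ∀ (xs ys : List ℕ) → length xs ≡ length ys → (∀ j → j < length xs → nth xs j ≡ nth ys j) → xs ≡ ys
nth-ext [] [] _ _ = refl
nth-ext (x ∷ xs) (y ∷ ys) same-length same =
  cong₂ _∷_ (same 0 (s≤s z≤n)) (nth-ext xs ys (suc-injective same-length) (λ j j<n → same (suc j) (s≤s j<n)))

concatMap-upTo-suc : (f : ℕ → List A) (n : ℕ) → concatMap f (upTo (suc n)) ≡ concatMap f (upTo n) ++ f n
concatMap-upTo-suc f n = begin
  concatMap f (upTo (suc n))            ≡⟨ cong (concatMap f) (L.upTo-∷ʳ n) ⟨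
  concatMap f (upTo n ++ (n ∷ []))      ≡⟨ L.concatMap-++ f (upTo n) (n ∷ []) ⟩
  concatMap f (upTo n) ++ (f n ++ [])   ≡⟨ cong (concatMap f (upTo n) ++_) (L.++-identityʳ (f n)) ⟩
  concatMap f (upTo n) ++ f n           ∎
  where open ≡-Reasoning

concatMap-upTo-cong : (f g : ℕ → List A) (n : ℕ) → (∀ x → x < n → f x ≡ g x) → concatMap f (upTo n) ≡ concatMap g (upTo n)
concatMap-upTo-cong f g zero _ = refl
concatMap-upTo-cong f g (suc n) f≡g = begin
  concatMap f (upTo (suc n))       ≡⟨ concatMap-upTo-suc f n ⟩
  concatMap f (upTo n) ++ f n      ≡⟨ cong₂ _++_ (concatMap-upTo-cong f g n (λ x x<n → f≡g x (m<n⇒m<1+n x<n))) (f≡g n ≤-refl) ⟩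
  concatMap g (upTo n) ++ g n      ≡⟨ concatMap-upTo-suc g n ⟨
  concatMap g (upTo (suc n))       ∎
  where open ≡-Reasoning

concatMap-++-↭ : (f g : A → List B) (xs : List A) → concatMap (λ x → f x ++ g x) xs ↭ concatMap f xs ++ concatMap g xs
concatMap-++-↭ f g [] = ↭-refl
concatMap-++-↭ f g (x ∷ xs) = begin
  (f x ++ g x) ++ concatMap (λ x → f x ++ g x) xs     ≡⟨ L.++-assoc (f x) (g x) _ ⟩
  f x ++ g x ++ concatMap (λ x → f x ++ g x) xs       ↭⟨ ++⁺ˡ (f x) (++⁺ˡ (g x) (concatMap-++-↭ f g xs)) ⟩
  f x ++ g x ++ concatMap f xs ++ concatMap g xs      ↭⟨ ++⁺ˡ (f x) (shifts (g x) (concatMap f xs)) ⟩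
  f x ++ concatMap f xs ++ g x ++ concatMap g xs      ≡⟨ L.++-assoc (f x) (concatMap f xs) _ ⟨
  (f x ++ concatMap f xs) ++ g x ++ concatMap g xs    ∎
  where open PermutationReasoning

concatMap-comm : (f : A → B → List C) (xs : List A) (ys : List B) →
                 concatMap (λ x → concatMap (f x) ys) xs ↭ concatMap (λ y → concatMap (λ x → f x y) xs) ys
concatMap-comm f xs [] = ↭-reflexive (concatMap-[] xs)
  where
  concatMap-[] : ∀ xs → concatMap (λ x → concatMap (f x) []) xs ≡ []
  concatMap-[] [] = refl
  concatMap-[] (x ∷ xs) = concatMap-[] xs
concatMap-comm f xs (y ∷ ys) = ↭-trans (concatMap-++-↭ (λ x → f x y) (λ x → concatMap (f x) ys) xs)
                                       (++⁺ˡ (concatMap (λ x → f x y) xs) (concatMap-comm f xs ys))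

≡ᵇ-refl : ∀ n → (n ≡ᵇ n) ≡ true
≡ᵇ-refl zero = refl
≡ᵇ-refl (suc n) = ≡ᵇ-refl n

≢⇒≡ᵇ-false : ∀ {m n} → m ≢ n → (m ≡ᵇ n) ≡ false
≢⇒≡ᵇ-false {m} {n} m≢n with m ≡ᵇ n in eq
... | true = ⊥-elim (m≢n (≡ᵇ⇒≡ m n (subst T (sym eq) _)))
... | false = refl

<ᵇ-true : ∀ {m n} → m < n → (m <ᵇ n) ≡ true
<ᵇ-true {zero} {suc n} _ = refl
<ᵇ-true {suc m} {suc n} (s≤s m<n) = <ᵇ-true m<n

<ᵇ-false : ∀ {m n} → n ≤ m → (m <ᵇ n) ≡ false
<ᵇ-false {m} {zero} _ = refl
<ᵇ-false {suc m} {suc n} (s≤s n≤m) = <ᵇ-false n≤m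

sum₁ : ℕ → (ℕ → ℕ) → ℕ
sum₁ zero f = 0
sum₁ (suc n) f = f 1 + sum₁ n (f ∘ suc)

sum₁-mono-≤ : ∀ n {f g : ℕ → ℕ} → (∀ c → 1 ≤ c → c ≤ n → f c ≤ g c) → sum₁ n f ≤ sum₁ n g
sum₁-mono-≤ zero f≤g = z≤n
sum₁-mono-≤ (suc n) f≤g =
  +-mono-≤ (f≤g 1 ≤-refl (s≤s z≤n)) (sum₁-mono-≤ n λ c _ c≤n → f≤g (suc c) (s≤s z≤n) (s≤s c≤n))

sum₁-mono-< : ∀ n {f g : ℕ → ℕ} → (∀ c → 1 ≤ c → c ≤ n → f c ≤ g c) →
              ∀ c → 1 ≤ c → c ≤ n → f c < g c → sum₁ n f < sum₁ n g
sum₁-mono-< (suc n) f≤g (suc zero) _ _ fc<gc =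
  +-mono-<-≤ fc<gc (sum₁-mono-≤ n λ c _ c≤n → f≤g (suc c) (s≤s z≤n) (s≤s c≤n))
sum₁-mono-< (suc n) f≤g (suc (suc c)) _ (s≤s c<n) fc<gc =
  +-mono-≤-< (f≤g 1 ≤-refl (s≤s z≤n))
             (sum₁-mono-< n (λ c _ c≤n → f≤g (suc c) (s≤s z≤n) (s≤s c≤n)) (suc c) (s≤s z≤n) c<n fc<gc)

sum₁-suc : ∀ n (g : ℕ → ℕ) → sum₁ n (suc ∘ g) ≡ n + sum₁ n g
sum₁-suc zero g = refl
sum₁-suc (suc n) g = cong suc (trans (cong (g 1 +_) (sum₁-suc n (g ∘ suc))) (x∙yz≈y∙xz (g 1) n _))

sum₁-const+ : ∀ n a (g : ℕ → ℕ) → sum₁ n (λ c → a + g c) ≡ n * a + sum₁ n g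
sum₁-const+ zero a g = refl
sum₁-const+ (suc n) a g = trans (cong ((a + g 1) +_) (sum₁-const+ n a (g ∘ suc))) (interchange a (g 1) (n * a) _)

sum₁-tight : ∀ n {f g : ℕ → ℕ} → (∀ c → 1 ≤ c → c ≤ n → f c ≤ suc (g c)) → n + sum₁ n g ≤ sum₁ n f →
             ∀ c → 1 ≤ c → c ≤ n → f c ≡ suc (g c)
sum₁-tight zero _ _ (suc c) _ ()
sum₁-tight (suc n) {f} {g} f≤g+1 apart = tight
  where
  f≤g+1′ : ∀ c → 1 ≤ c → c ≤ n → f (suc c) ≤ suc (g (suc c))
  f≤g+1′ c _ c≤n = f≤g+1 (suc c) (s≤s z≤n) (s≤s c≤n)
  tight-pair : ∀ {a b A B} → a ≤ A → b ≤ B → A + B ≤ a + b → a ≡ A × b ≡ B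
  tight-pair {a} {b} {A} {B} a≤A b≤B A+B≤a+b =
    ≤-antisym a≤A (+-cancelʳ-≤ B A a (≤-trans A+B≤a+b (+-monoʳ-≤ a b≤B))) ,
    ≤-antisym b≤B (+-cancelˡ-≤ A B b (≤-trans A+B≤a+b (+-monoˡ-≤ b a≤A)))
  first-and-rest : f 1 ≡ suc (g 1) × sum₁ n (f ∘ suc) ≡ n + sum₁ n (g ∘ suc)
  first-and-rest = tight-pair (f≤g+1 1 ≤-refl (s≤s z≤n))
    (≤-trans (sum₁-mono-≤ n f≤g+1′) (≤-reflexive (sum₁-suc n (g ∘ suc))))
    (≤-trans (≤-reflexive (cong suc (x∙yz≈y∙xz (g 1) n _))) apart)
  tight : ∀ c → 1 ≤ c → c ≤ suc n → f c ≡ suc (g c)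
  tight (suc zero) _ _ = proj₁ first-and-rest
  tight (suc (suc c)) _ (s≤s c<n) = sum₁-tight n f≤g+1′ (≤-reflexive (sym (proj₂ first-and-rest))) (suc c) (s≤s z≤n) c<n

data Chain (R : A → A → B → Set) : ∀ {k} → Vec A (suc k) → Vec B k → Set where
  [_] : ∀ x → Chain R (x ∷ []) []
  _∷_ : ∀ {k x y} {xs : Vec A k} {l ls} → R x y l → Chain R (y ∷ xs) ls → Chain R (x ∷ y ∷ xs) (l ∷ ls)

Chain-∷ʳ : ∀ {xs : Vec A (suc k)} {ls x l} → Chain R xs ls → R (last′ xs) x l → Chain R (xs ∷ʳ x) (ls ∷ʳ l)
Chain-∷ʳ [ y ] r = r ∷ [ _ ]
Chain-∷ʳ (r′ ∷ c) r = r′ ∷ Chain-∷ʳ c r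

Chain-reverse : ∀ {xs : Vec A (suc k)} {ls} → Chain R xs ls → Chain (flip R) (V.reverse xs) (V.reverse ls)
Chain-reverse [ x ] = [ x ]
Chain-reverse {R = R} (_∷_ {x = x} {y} {xs} {l} {ls} r c) =
  subst₂ (Chain (flip R)) (sym (V.reverse-∷ x (y ∷ xs))) (sym (V.reverse-∷ l ls))
    (Chain-∷ʳ (Chain-reverse c) (subst (λ v → R x v l) (sym (last′-reverse (y ∷ xs))) r))

Chain-all : ∀ {P : A → Set} {xs : Vec A (suc k)} {ls} → Chain R xs ls → P (V.head xs) →
            (∀ {x y l} → R x y l → P x → P y) → All P (toList xs)
Chain-all [ x ] px step = px ∷ []
Chain-all (r ∷ c) px step = px ∷ Chain-all c (step r px) step

Chain-tabulate : (f : Fin (suc k) → A) (g : Fin k → B) →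
                 (∀ a → R (f (inject₁ a)) (f (suc a)) (g a)) → Chain R (tabulate f) (tabulate g)
Chain-tabulate {k = zero} f g step = [ f zero ]
Chain-tabulate {k = suc k} f g step = step zero ∷ Chain-tabulate (f ∘ suc) (g ∘ suc) (step ∘ suc)

-- Prefix sums and moves

prefix : ℕ → Pt n → ℕ
prefix c v = sum (L.take c (L.map b2n (toList v)))

prefix-weight : ∀ (v : Pt n) c → n ≤ c → prefix c v ≡ weight v
prefix-weight [] zero _ = refl
prefix-weight [] (suc c) _ = refl
prefix-weight (x ∷ v) (suc c) (s≤s n≤c) = cong (b2n x +_) (prefix-weight v c n≤c)

prefix-injective : ∀ (u v : Pt n) → (∀ c → c ≤ n → prefix c u ≡ prefix c v) → u ≡ v
prefix-injective [] [] _ = refl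
prefix-injective (a ∷ u) (b ∷ v) same = cong₂ _∷_ a≡b (prefix-injective u v λ c c≤n →
    +-cancelˡ-≡ (b2n a) _ _ (trans (same (suc c) (s≤s c≤n)) (cong (λ x → b2n x + prefix c v) (sym a≡b))))
  where
  b2n-injective : ∀ a b → b2n a ≡ b2n b → a ≡ b
  b2n-injective true true _ = refl
  b2n-injective false false _ = refl
  a≡b : a ≡ b
  a≡b = b2n-injective a b (trans (sym (+-identityʳ (b2n a))) (trans (same 1 (s≤s z≤n)) (+-identityʳ (b2n b))))

prefix-isum : ∀ a b (v : Pt n) → a ≤ b → prefix a v + isum a b v ≡ prefix b v
prefix-isum a b v = take-split a b (L.map b2n (toList v))
  where
  take-split : ∀ a b (xs : List ℕ) → a ≤ b → sum (L.take a xs) + sum (L.take (b ∸ a) (L.drop a xs)) ≡ sum (L.take b xs)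
  take-split zero b xs _ = refl
  take-split (suc a) (suc b) [] _ = cong sum (L.take-[] (b ∸ a))
  take-split (suc a) (suc b) (x ∷ xs) (s≤s a≤b) = trans (+-assoc x _ _) (cong (x +_) (take-split a b xs a≤b))

weight-∷ʳ : (z : Pt k) (b : Bool) → weight (z ∷ʳ b) ≡ weight z + b2n b
weight-∷ʳ [] b = +-identityʳ (b2n b)
weight-∷ʳ (x ∷ z) b = trans (cong (b2n x +_) (weight-∷ʳ z b)) (sym (+-assoc (b2n x) _ _))

<lex-trans : Transitive (_<lex_ {n})
<lex-trans here (there _) = here
<lex-trans (there _) here = here
<lex-trans (there u<v) (there v<w) = there (<lex-trans u<v v<w)

<lex-irrefl : Irreflexive _≡_ (_<lex_ {n})
<lex-irrefl refl (there u<u) = <lex-irrefl refl u<u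

<lex⇒prefix-< : ∀ {u v : Pt n} → u <lex v → ∃ λ c → prefix c u < prefix c v
<lex⇒prefix-< here = 1 , s≤s z≤n
<lex⇒prefix-< (there {b = b} u<v) = Product.map suc (+-monoʳ-< (b2n b)) (<lex⇒prefix-< u<v)

data Move : Pt (suc n) → Pt (suc n) → Fin n → Set where
  here : ∀ {xs : Pt n} → Move (false ∷ true ∷ xs) (true ∷ false ∷ xs) zero
  there : ∀ {b} {xs ys : Pt (suc n)} {p} → Move xs ys p → Move (b ∷ xs) (b ∷ ys) (suc p)

Move-<lex : ∀ {u v : Pt (suc n)} {p} → Move u v p → u <lex v
Move-<lex here = here
Move-<lex (there m) = there (Move-<lex m)

Move-weight : ∀ {u v : Pt (suc n)} {p} → Move u v p → weight u ≡ weight v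
Move-weight here = refl
Move-weight (there {b = b} m) = cong (b2n b +_) (Move-weight m)

Move-prefix : ∀ {u v : Pt (suc n)} {p} → Move u v p → ∀ c → prefix c u ≤ prefix c v
Move-prefix m zero = z≤n
Move-prefix here (suc zero) = z≤n
Move-prefix here (suc (suc c)) = ≤-refl
Move-prefix (there {b = b} m) (suc c) = +-monoʳ-≤ (b2n b) (Move-prefix m c)

Move-coordinate : ∀ {u v u′ v′ : Pt (suc n)} {p} → Move u v p → Move u′ v′ p → ∀ j →
                  (lookup u j ≡ lookup u′ j → lookup v j ≡ lookup v′ j) × (lookup v j ≡ lookup v′ j → lookup u j ≡ lookup u′ j)
Move-coordinate here here zero = (λ _ → refl) , (λ _ → refl)
Move-coordinate here here (suc zero) = (λ _ → refl) , (λ _ → refl)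
Move-coordinate here here (suc (suc j)) = (λ eq → eq) , (λ eq → eq)
Move-coordinate (there _) (there _) zero = (λ eq → eq) , (λ eq → eq)
Move-coordinate (there move) (there move′) (suc j) = Move-coordinate move move′ j

Move-target : ∀ {u v : Pt (suc n)} {p} → Move u v p → lookup v (inject₁ p) ≡ true × lookup v (suc p) ≡ false
Move-target here = refl , refl
Move-target (there move) = Move-target move

Move-intro : ∀ (u v : Pt (suc n)) p → lookup u (inject₁ p) ≡ false → lookup u (suc p) ≡ true →
             lookup v (inject₁ p) ≡ true → lookup v (suc p) ≡ false →
             (∀ j → toℕ j ≢ toℕ p → toℕ j ≢ suc (toℕ p) → lookup u j ≡ lookup v j) → Move u v p
Move-intro (false ∷ true ∷ u) (true ∷ false ∷ v) zero refl refl refl refl elsewhere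
  rewrite lookup-ext u v (λ j → elsewhere (suc (suc j)) (λ ()) (λ ())) = here
Move-intro (a ∷ u) (b ∷ v) (suc p) u₀ u₁ v₀ v₁ elsewhere rewrite elsewhere zero (λ ()) (λ ()) =
  there (Move-intro u v p u₀ u₁ v₀ v₁ (λ j j≢p j≢p+1 → elsewhere (suc j) (j≢p ∘ suc-injective) (j≢p+1 ∘ suc-injective)))

-- The vertices of an alcove form a chain of moves

prefixTotal : Pt (suc n) → ℕ
prefixTotal {n} v = sum₁ n (λ c → prefix c v)

prefixTotal-∷ : ∀ a (v : Pt (suc n)) → prefixTotal (a ∷ v) ≡ suc n * b2n a + prefixTotal v
prefixTotal-∷ {n} a v = begin
  b2n a + 0 + sum₁ n (λ c → b2n a + prefix c v)  ≡⟨ cong₂ _+_ (+-identityʳ (b2n a)) (sum₁-const+ n (b2n a) (λ c → prefix c v)) ⟩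
  b2n a + (n * b2n a + prefixTotal v)           ≡⟨ +-assoc (b2n a) _ _ ⟨
  suc n * b2n a + prefixTotal v                 ∎
  where open ≡-Reasoning

prefix-suc⇒ : ∀ (x y : Pt (suc n)) → (∀ c → 1 ≤ c → c ≤ suc n → prefix c x ≡ suc (prefix c y)) →
              ∃ λ t → x ≡ true ∷ t × y ≡ false ∷ t
prefix-suc⇒ (true ∷ x) (false ∷ y) shifted =
  x , refl , cong (false ∷_) (sym (prefix-injective x y λ c c≤n → suc-injective (shifted (suc c) (s≤s z≤n) (s≤s c≤n))))
prefix-suc⇒ (true ∷ x) (true ∷ y) shifted = ⊥-elim (1+n≢n (sym (suc-injective (shifted 1 ≤-refl (s≤s z≤n)))))
prefix-suc⇒ (false ∷ x) (b ∷ y) shifted = ⊥-elim (1+n≢0 (sym (shifted 1 ≤-refl (s≤s z≤n))))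

prefix-last⇒ : ∀ (x y : Pt (suc n)) → (∀ c → c ≤ n → prefix c x ≡ prefix c y) → prefix (suc n) y ≡ suc (prefix (suc n) x) →
               ∃ λ z → x ≡ z ∷ʳ false × y ≡ z ∷ʳ true
prefix-last⇒ {zero} (false ∷ []) (true ∷ []) _ _ = [] , refl , refl
prefix-last⇒ {zero} (false ∷ []) (false ∷ []) _ ()
prefix-last⇒ {zero} (true ∷ []) (true ∷ []) _ ()
prefix-last⇒ {zero} (true ∷ []) (false ∷ []) _ ()
prefix-last⇒ {suc n} (a ∷ x) (b ∷ y) same more with cong V.head (prefix-injective (a ∷ []) (b ∷ []) heads)
  where
  heads : ∀ c → c ≤ 1 → prefix c (a ∷ []) ≡ prefix c (b ∷ [])
  heads zero _ = refl
  heads (suc zero) _ = same 1 (s≤s z≤n)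
  heads (suc (suc c)) (s≤s ())
... | refl with prefix-last⇒ x y (λ c c≤n → +-cancelˡ-≡ (b2n a) _ _ (same (suc c) (s≤s c≤n)))
                                  (+-cancelˡ-≡ (b2n a) _ _ (trans more (sym (+-suc (b2n a) _))))
...   | z , refl , refl = a ∷ z , refl , refl

prefixTotal-cancel : ∀ a (u v : Pt (suc n)) → prefixTotal (a ∷ v) ≡ suc (prefixTotal (a ∷ u)) → prefixTotal v ≡ suc (prefixTotal u)
prefixTotal-cancel {n} a u v one-more = +-cancelˡ-≡ (suc n * b2n a) _ _ (begin
  suc n * b2n a + prefixTotal v          ≡⟨ prefixTotal-∷ a v ⟨
  prefixTotal (a ∷ v)                    ≡⟨ one-more ⟩
  suc (prefixTotal (a ∷ u))              ≡⟨ cong suc (prefixTotal-∷ a u) ⟩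
  suc (suc n * b2n a + prefixTotal u)    ≡⟨ +-suc (suc n * b2n a) _ ⟨
  suc n * b2n a + suc (prefixTotal u)    ∎)
  where open ≡-Reasoning

prefix-step⇒Move : ∀ (u v : Pt (suc n)) → (∀ c → prefix c u ≤ prefix c v) → weight u ≡ weight v →
                   prefixTotal v ≡ suc (prefixTotal u) → Σ (Fin n) (Move u v)
prefix-step⇒Move {zero} u v _ _ ()
prefix-step⇒Move {suc m} (true ∷ u) (false ∷ v) u≤v _ _ = ⊥-elim (1+n≰n (u≤v 1))
prefix-step⇒Move {suc m} (false ∷ u) (false ∷ v) u≤v same-weight one-more =
  Product.map suc there (prefix-step⇒Move u v (u≤v ∘ suc) same-weight (prefixTotal-cancel false u v one-more))
prefix-step⇒Move {suc m} (true ∷ u) (true ∷ v) u≤v same-weight one-more =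
  Product.map suc there (prefix-step⇒Move u v (λ c → +-cancelˡ-≤ 1 _ _ (u≤v (suc c))) (suc-injective same-weight)
                                               (prefixTotal-cancel true u v one-more))
prefix-step⇒Move {suc m} (false ∷ u) (true ∷ v) u≤v same-weight one-more with prefix-suc⇒ u v shifted
  where
  rest-total : m + prefixTotal v ≡ prefixTotal u
  rest-total = suc-injective (begin
    suc m + prefixTotal v                 ≡⟨ cong (_+ prefixTotal v) (cong suc (*-identityʳ m)) ⟨
    suc m * 1 + prefixTotal v             ≡⟨ prefixTotal-∷ true v ⟨
    prefixTotal (true ∷ v)                ≡⟨ one-more ⟩
    suc (prefixTotal (false ∷ u))         ≡⟨ cong suc (trans (prefixTotal-∷ false u) (cong (_+ prefixTotal u) (*-zeroʳ m))) ⟩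
    suc (prefixTotal u)                   ∎)
    where open ≡-Reasoning
  shifted : ∀ c → 1 ≤ c → c ≤ suc m → prefix c u ≡ suc (prefix c v)
  shifted c 1≤c c≤1+m with m≤n⇒m<n∨m≡n c≤1+m
  ... | inj₁ (s≤s c≤m) = sum₁-tight m (λ c _ _ → u≤v (suc c)) (≤-reflexive rest-total) c 1≤c c≤m
  ... | inj₂ refl = trans (prefix-weight u (suc m) ≤-refl) (trans same-weight (cong suc (sym (prefix-weight v (suc m) ≤-refl))))
... | t , refl , refl = zero , here

module Unseparated {d i : ℕ} {M : Pt (suc d) → Set} (weight-M : ∀ {u} → M u → weight u ≡ i)
  (unseparated : ∀ a b → a < b → b ≤ suc d → ∀ u v → M u → M v → isum a b u ≤ isum a b v + 1) where

  prefix-beyond : ∀ {u v} → M u → M v → ∀ c → suc d ≤ c → prefix c u ≡ prefix c v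
  prefix-beyond {u} {v} mu mv c d<c =
    trans (prefix-weight u c d<c) (trans (weight-M mu) (sym (trans (prefix-weight v c d<c) (weight-M mv))))

  no-crossing : ∀ {u v a b} → M u → M v → a < b → b ≤ suc d → prefix a u < prefix a v → prefix b v < prefix b u → ⊥
  no-crossing {u} {v} {a} {b} mu mv a<b b≤1+d ua<va vb<ub = <-irrefl refl (≤-trans vb<ub ub≤vb)
    where
    open ≤-Reasoning
    ub≤vb : prefix b u ≤ prefix b v
    ub≤vb = begin
      prefix b u                     ≡⟨ prefix-isum a b u (<⇒≤ a<b) ⟨
      prefix a u + isum a b u        ≤⟨ +-monoʳ-≤ (prefix a u) (unseparated a b a<b b≤1+d u v mu mv) ⟩
      prefix a u + (isum a b v + 1)  ≡⟨ trans (cong (prefix a u +_) (+-comm (isum a b v) 1)) (+-suc (prefix a u) (isum a b v)) ⟩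
      suc (prefix a u) + isum a b v  ≤⟨ +-monoˡ-≤ (isum a b v) ua<va ⟩
      prefix a v + isum a b v        ≡⟨ prefix-isum a b v (<⇒≤ a<b) ⟩
      prefix b v                     ∎

  prefix-comparable : ∀ {u v} → M u → M v → (∀ c → prefix c u ≤ prefix c v) ⊎ (∀ c → prefix c v ≤ prefix c u)
  prefix-comparable {u} {v} mu mv with Fin.all? (λ (c : Fin (suc (suc d))) → prefix (toℕ c) u ≤? prefix (toℕ c) v)
  ... | yes u≤v = inj₁ λ c → everywhere c (c ≤? suc d)
    where
    everywhere : ∀ c → Dec (c ≤ suc d) → prefix c u ≤ prefix c v
    everywhere c (yes c≤1+d) = subst (λ x → prefix x u ≤ prefix x v) (Fin.toℕ-fromℕ< (s≤s c≤1+d)) (u≤v (fromℕ< (s≤s c≤1+d)))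
    everywhere c (no c≰1+d) = ≤-reflexive (prefix-beyond mu mv c (<⇒≤ (≰⇒> c≰1+d)))
  ... | no u≰v with Fin.¬∀⟶∃¬ _ _ (λ c → prefix (toℕ c) u ≤? prefix (toℕ c) v) u≰v
  ...   | b , ub≰vb = inj₂ v≤u
    where
    vb<ub : prefix (toℕ b) v < prefix (toℕ b) u
    vb<ub = ≰⇒> ub≰vb
    crossing : ∀ a → prefix a u < prefix a v → Dec (a ≤ suc d) → ⊥
    crossing a ua<va (no a≰1+d) = <-irrefl (prefix-beyond mu mv a (<⇒≤ (≰⇒> a≰1+d))) ua<va
    crossing a ua<va (yes a≤1+d) with <-cmp a (toℕ b)
    ... | tri< a<b _ _ = no-crossing mu mv a<b (≤-pred (Fin.toℕ<n b)) ua<va vb<ub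
    ... | tri≈ _ refl _ = <-asym ua<va vb<ub
    ... | tri> _ _ b<a = no-crossing mv mu b<a a≤1+d vb<ub ua<va
    v≤u : ∀ a → prefix a v ≤ prefix a u
    v≤u a with prefix a v ≤? prefix a u
    ... | yes va≤ua = va≤ua
    ... | no va≰ua = ⊥-elim (crossing a (≰⇒> va≰ua) (a ≤? suc d))

  <lex⇒prefix-step : ∀ {u v} → u <lex v → M u → M v → (∀ c → prefix c u ≤ prefix c v) × prefixTotal u < prefixTotal v
  <lex⇒prefix-step {u} {v} u<v mu mv with prefix-comparable mu mv | <lex⇒prefix-< u<v
  ... | inj₂ v≤u | c , uc<vc = ⊥-elim (<-irrefl refl (≤-trans uc<vc (v≤u c)))
  ... | inj₁ u≤v | c , uc<vc = u≤v , sum₁-mono-< d (λ c _ _ → u≤v c) c (1≤c c uc<vc) (c≤d (c ≤? d)) uc<vc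
    where
    1≤c : ∀ c → prefix c u < prefix c v → 1 ≤ c
    1≤c zero ()
    1≤c (suc _) _ = s≤s z≤n
    c≤d : Dec (c ≤ d) → c ≤ d
    c≤d (yes c≤d) = c≤d
    c≤d (no c≰d) = ⊥-elim (<-irrefl (prefix-beyond mu mv c (≰⇒> c≰d)) uc<vc)

  sorted-prefix : ∀ {x} {xs : Vec (Pt (suc d)) k} → StrictlyIncreasing (x ∷ xs) → All M (toList (x ∷ xs)) →
                  (∀ c → prefix c x ≤ prefix c (last′ (x ∷ xs))) × (k + prefixTotal x ≤ prefixTotal (last′ (x ∷ xs)))
  sorted-prefix [ x ] _ = (λ c → ≤-refl) , ≤-refl
  sorted-prefix {x = x} {xs = y ∷ ys} (x<y ∷ sorted) (mx ∷ my ∷ ms) =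
    let (x≤y , x<ᵗy) = <lex⇒prefix-step x<y mx my
        (y≤l , y+k≤l) = sorted-prefix sorted (my ∷ ms)
    in (λ c → ≤-trans (x≤y c) (y≤l c)) ,
       ≤-trans (≤-reflexive (sym (+-suc _ (prefixTotal x)))) (≤-trans (+-monoʳ-≤ _ x<ᵗy) y+k≤l)

  -- k strict increases of prefixTotal within a total increase of at most k are all by one
  sorted-moveChain : ∀ {x} {xs : Vec (Pt (suc d)) k} → StrictlyIncreasing (x ∷ xs) → All M (toList (x ∷ xs)) →
                     prefixTotal (last′ (x ∷ xs)) ≤ k + prefixTotal x → ∃ (Chain Move (x ∷ xs))
  sorted-moveChain [ x ] _ _ = [] , [ x ]
  sorted-moveChain {k = suc k} {x = x} {xs = y ∷ ys} (x<y ∷ sorted) (mx ∷ my ∷ ms) bound =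
    proj₁ move ∷ proj₁ rest , proj₂ move ∷ proj₂ rest
    where
    step : (∀ c → prefix c x ≤ prefix c y) × prefixTotal x < prefixTotal y
    step = <lex⇒prefix-step x<y mx my
    one-more : prefixTotal y ≡ suc (prefixTotal x)
    one-more = ≤-antisym (+-cancelˡ-≤ k _ _ (≤-trans (proj₂ (sorted-prefix sorted (my ∷ ms)))
                                               (≤-trans bound (≤-reflexive (sym (+-suc k (prefixTotal x))))))) (proj₂ step)
    move : Σ (Fin d) (Move x y)
    move = prefix-step⇒Move x y (proj₁ step) (trans (weight-M mx) (sym (weight-M my))) one-more
    rest : ∃ (Chain Move (y ∷ ys))
    rest = sorted-moveChain sorted (my ∷ ms) (≤-trans bound (≤-reflexive (trans (sym (+-suc k _)) (cong (k +_) (sym one-more)))))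

endpoints : ∀ {m} (h l : Pt (suc (suc m))) → (∀ c → 1 ≤ c → c ≤ suc m → prefix c l ≡ suc (prefix c h)) → weight h ≡ weight l →
            ∃ λ z → h ≡ false ∷ (z ∷ʳ true) × l ≡ true ∷ (z ∷ʳ false)
endpoints (false ∷ h) (true ∷ l) shifted same-weight
  with prefix-last⇒ l h (λ c c≤m → suc-injective (shifted (suc c) (s≤s z≤n) (s≤s c≤m)))
                        (trans (prefix-weight h _ ≤-refl) (trans same-weight (cong suc (sym (prefix-weight l _ ≤-refl)))))
... | z , refl , refl = z , refl , refl
endpoints (false ∷ h) (false ∷ l) shifted _ = ⊥-elim (0≢1+n (shifted 1 ≤-refl (s≤s z≤n)))
endpoints (true ∷ h) (false ∷ l) shifted _ = ⊥-elim (0≢1+n (shifted 1 ≤-refl (s≤s z≤n)))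
endpoints (true ∷ h) (true ∷ l) shifted _ = ⊥-elim (0≢1+n (suc-injective (shifted 1 ≤-refl (s≤s z≤n))))

record MoveChain {m} (vs : Vec (Pt (suc (suc m))) (suc (suc m))) : Set where
  field
    labels : Vec (Fin (suc m)) (suc m)
    moves : Chain Move vs labels
    middle : Pt m
    starts : V.head vs ≡ false ∷ (middle ∷ʳ true)
    ends : last′ vs ≡ true ∷ (middle ∷ʳ false)

unseparated-moveChain : ∀ {m i} (vs : Vec (Pt (suc (suc m))) (suc (suc m))) → StrictlyIncreasing vs →
  All (λ v → weight v ≡ i) (toList vs) →
  (∀ a b → a < b → b ≤ suc (suc m) → ∀ u v → u ∈ toList vs → v ∈ toList vs → isum a b u ≤ isum a b v + 1) →
  MoveChain vs
unseparated-moveChain {m} (x ∷ xs) sorted same-weight unseparated = record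
  { labels = proj₁ moves ; moves = proj₂ moves ; middle = proj₁ ends ; starts = proj₁ (proj₂ ends) ; ends = proj₂ (proj₂ ends) }
  where
  open Unseparated (All.lookup same-weight) unseparated
  l : Pt (suc (suc m))
  l = last′ (x ∷ xs)
  all-in : All (_∈ toList (x ∷ xs)) (toList (x ∷ xs))
  all-in = All.tabulate (λ u∈ → u∈)
  l≤x+1 : ∀ c → 1 ≤ c → c ≤ suc m → prefix c l ≤ suc (prefix c x)
  l≤x+1 c 1≤c c≤1+m =
    ≤-trans (unseparated 0 c 1≤c (m≤n⇒m≤1+n c≤1+m) l x (last′-∈ (x ∷ xs)) (here refl)) (≤-reflexive (+-comm _ 1))
  moves : ∃ (Chain Move (x ∷ xs))
  moves = sorted-moveChain sorted all-in (≤-trans (sum₁-mono-≤ (suc m) l≤x+1) (≤-reflexive (sum₁-suc (suc m) (λ c → prefix c x))))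
  ends : ∃ λ z → x ≡ false ∷ (z ∷ʳ true) × l ≡ true ∷ (z ∷ʳ false)
  ends = endpoints x l (sum₁-tight (suc m) l≤x+1 (proj₂ (sorted-prefix sorted all-in)))
                       (trans (All.lookup same-weight (here refl)) (sym (All.lookup same-weight (last′-∈ (x ∷ xs)))))

alcove-moveChain : ∀ {m i} (A : Alcove (suc m) i) → MoveChain (Alcove.verts A)
alcove-moveChain A = unseparated-moveChain verts canon inΔ inCell
  where open Alcove A

-- Alcoves from chains of moves

Chain-increasing : ∀ {xs : Vec (Pt (suc n)) (suc k)} {ps} → Chain Move xs ps → StrictlyIncreasing xs
Chain-increasing [ x ] = [ x ]
Chain-increasing (move ∷ [ y ]) = Move-<lex move ∷ [ y ]
Chain-increasing (move ∷ moves@(_ ∷ _)) = Move-<lex move ∷ Chain-increasing moves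

Chain-weight : ∀ {xs : Vec (Pt (suc n)) (suc k)} {ps} → Chain Move xs ps → All (λ v → weight v ≡ weight (V.head xs)) (toList xs)
Chain-weight moves = Chain-all moves refl (λ move same → trans (sym (Move-weight move)) same)

Chain-prefix-head : ∀ {xs : Vec (Pt (suc n)) (suc k)} {ps} → Chain Move xs ps →
                    ∀ {u} → u ∈ toList xs → ∀ c → prefix c (V.head xs) ≤ prefix c u
Chain-prefix-head [ x ] (here refl) c = ≤-refl
Chain-prefix-head (move ∷ moves) (here refl) c = ≤-refl
Chain-prefix-head (move ∷ moves) (there u∈) c = ≤-trans (Move-prefix move c) (Chain-prefix-head moves u∈ c)

Chain-prefix-last : ∀ {xs : Vec (Pt (suc n)) (suc k)} {ps} → Chain Move xs ps →
                    ∀ {u} → u ∈ toList xs → ∀ c → prefix c u ≤ prefix c (last′ xs)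
Chain-prefix-last [ x ] (here refl) c = ≤-refl
Chain-prefix-last (move ∷ moves) (here refl) c = ≤-trans (Move-prefix move c) (Chain-prefix-last moves (here refl) c)
Chain-prefix-last (move ∷ moves) (there u∈) c = Chain-prefix-last moves u∈ c

Chain-prefix-comparable : ∀ {xs : Vec (Pt (suc n)) (suc k)} {ps} → Chain Move xs ps → ∀ {u v} → u ∈ toList xs → v ∈ toList xs →
                          (∀ c → prefix c u ≤ prefix c v) ⊎ (∀ c → prefix c v ≤ prefix c u)
Chain-prefix-comparable moves@([ _ ]) (here refl) v∈ = inj₁ (Chain-prefix-head moves v∈)
Chain-prefix-comparable moves@(_ ∷ _) (here refl) v∈ = inj₁ (Chain-prefix-head moves v∈)
Chain-prefix-comparable moves@(_ ∷ _) (there u∈) (here refl) = inj₂ (Chain-prefix-head moves (there u∈))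
Chain-prefix-comparable (move ∷ moves) (there u∈) (there v∈) = Chain-prefix-comparable moves u∈ v∈

prefix-1z0≤0z1+1 : ∀ {m} (z : Pt m) c → prefix c (true ∷ (z ∷ʳ false)) ≤ suc (prefix c (false ∷ (z ∷ʳ true)))
prefix-1z0≤0z1+1 z zero = z≤n
prefix-1z0≤0z1+1 z (suc c) = s≤s (snoc-mono z c)
  where
  snoc-mono : ∀ {k} (z : Pt k) c → prefix c (z ∷ʳ false) ≤ prefix c (z ∷ʳ true)
  snoc-mono z zero = z≤n
  snoc-mono [] (suc c) = n≤1+n _
  snoc-mono (x ∷ z) (suc c) = +-monoʳ-≤ (b2n x) (snoc-mono z c)

isum-≤ : ∀ a b (u v : Pt n) → a ≤ b → prefix b u + prefix a v ≤ suc (prefix b v + prefix a u) → isum a b u ≤ isum a b v + 1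
isum-≤ a b u v a≤b bound = +-cancelˡ-≤ (prefix a u + prefix a v) _ _ (begin
    prefix a u + prefix a v + isum a b u          ≡⟨ shuffle₁ (prefix a u) (prefix a v) (isum a b u) ⟩
    (prefix a u + isum a b u) + prefix a v        ≡⟨ cong (_+ prefix a v) (prefix-isum a b u a≤b) ⟩
    prefix b u + prefix a v                       ≤⟨ bound ⟩
    suc (prefix b v + prefix a u)                 ≡⟨ cong (λ x → suc (x + prefix a u)) (prefix-isum a b v a≤b) ⟨
    suc (prefix a v + isum a b v + prefix a u)    ≡⟨ shuffle₂ (prefix a u) (prefix a v) (isum a b v) ⟩
    prefix a u + prefix a v + (isum a b v + 1)    ∎)
  where
  open ≤-Reasoning
  shuffle₁ : ∀ x y z → x + y + z ≡ (x + z) + y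
  shuffle₁ = solve-∀
  shuffle₂ : ∀ x y z → suc (y + z + x) ≡ x + y + (z + 1)
  shuffle₂ = solve-∀

open Determinant using (differences; det-differences; adjacentDiff; diffMatrix; det-diffMatrix; sumᵥ)

Move-difference : ∀ {u v : Pt (suc n)} {p} → Move u v p → V.zipWith ℤ._-_ (V.map b2z u) (V.map b2z v) ≡ adjacentDiff p
Move-difference (here {xs = xs}) = cong (λ t → ℤ.-1ℤ ∷ ℤ.1ℤ ∷ t) (self-difference xs)
  where
  self-difference : ∀ {k} (xs : Pt k) → V.zipWith ℤ._-_ (V.map b2z xs) (V.map b2z xs) ≡ V.replicate k ℤ.0ℤ
  self-difference [] = refl
  self-difference (true ∷ xs) = cong (ℤ.0ℤ ∷_) (self-difference xs)
  self-difference (false ∷ xs) = cong (ℤ.0ℤ ∷_) (self-difference xs)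
Move-difference (there {b = true} move) = cong (ℤ.0ℤ ∷_) (Move-difference move)
Move-difference (there {b = false} move) = cong (ℤ.0ℤ ∷_) (Move-difference move)

differences-moveChain : ∀ {xs : Vec (Pt (suc n)) (suc k)} {ps} → Chain Move xs ps →
                        differences (toMatrix xs) ≡ diffMatrix ps (V.map b2z (last′ xs))
differences-moveChain [ x ] = refl
differences-moveChain (move ∷ moves) = cong₂ _∷_ (Move-difference move) (differences-moveChain moves)

sumᵥ-b2z : (v : Pt n) → sumᵥ (V.map b2z v) ≡ ℤ.+ weight v
sumᵥ-b2z [] = refl
sumᵥ-b2z (true ∷ v) = cong (λ t → ℤ.1ℤ ℤ.+ t) (sumᵥ-b2z v)
sumᵥ-b2z (false ∷ v) = trans (cong (λ t → ℤ.0ℤ ℤ.+ t) (sumᵥ-b2z v)) (ℤ.+-identityˡ _)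

-- Subtracting consecutive rows leaves the rows e_{p+1} − e_p and the last point,
-- whose coordinates add up to its weight.
det-moveChain : ∀ {xs : Vec (Pt (suc n)) (suc n)} {ps} → Chain Move xs ps → Vecᵘ.Unique ps →
                det (toMatrix xs) ≡ ℤ.+ weight (last′ xs) ⊎ det (toMatrix xs) ≡ ℤ.- (ℤ.+ weight (last′ xs))
det-moveChain {xs = xs} {ps} moves distinct rewrite sym (det-differences (toMatrix xs)) | differences-moveChain moves
  | sym (sumᵥ-b2z (last′ xs)) = det-diffMatrix ps distinct (V.map b2z (last′ xs))

moveChain-independent : ∀ {xs : Vec (Pt (suc n)) (suc n)} {ps} → Chain Move xs ps → Vecᵘ.Unique ps → 1 ≤ weight (last′ xs) →
                        ¬ det (toMatrix xs) ≡ ℤ.0ℤ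
moveChain-independent {xs = xs} moves distinct 1≤w det≡0 =
  <⇒≢ 1≤w (sym (ℤ.+-injective (weight≡0 (det-moveChain moves distinct))))
  where
  weight≡0 : det (toMatrix xs) ≡ ℤ.+ weight (last′ xs) ⊎ det (toMatrix xs) ≡ ℤ.- (ℤ.+ weight (last′ xs)) →
             ℤ.+ weight (last′ xs) ≡ ℤ.0ℤ
  weight≡0 (inj₁ det≡w) = trans (sym det≡w) det≡0
  weight≡0 (inj₂ det≡-w) = ℤ.neg-injective {j = ℤ.0ℤ} (trans (sym det≡-w) det≡0)

moveChain-alcove : ∀ {m i} {vs : Vec (Pt (suc (suc m))) (suc (suc m))} (mc : MoveChain vs) → Vecᵘ.Unique (MoveChain.labels mc) →
                   weight (V.head vs) ≡ i → 1 ≤ i → Alcove (suc m) i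
moveChain-alcove {m} {i} {vs} mc distinct weight≡i 1≤i = record
  { verts = vs
  ; canon = Chain-increasing moves
  ; inΔ = All.map (λ w≡ → trans w≡ weight≡i) (Chain-weight moves)
  ; indep = moveChain-independent moves distinct (subst (1 ≤_) (sym weight-last) 1≤i)
  ; inCell = unseparated
  }
  where
  open MoveChain mc
  weight-last : weight (last′ vs) ≡ i
  weight-last = trans (All.lookup (Chain-weight moves) (last′-∈ vs)) weight≡i
  spread : ∀ {u v} → u ∈ toList vs → v ∈ toList vs → ∀ c → prefix c u ≤ suc (prefix c v)
  spread {u} {v} u∈ v∈ c = begin
    prefix c u                                  ≤⟨ Chain-prefix-last moves u∈ c ⟩
    prefix c (last′ vs)                         ≡⟨ cong (prefix c) ends ⟩
    prefix c (true ∷ (middle ∷ʳ false))         ≤⟨ prefix-1z0≤0z1+1 middle c ⟩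
    suc (prefix c (false ∷ (middle ∷ʳ true)))   ≡⟨ cong (suc ∘ prefix c) starts ⟨
    suc (prefix c (V.head vs))                  ≤⟨ s≤s (Chain-prefix-head moves v∈ c) ⟩
    suc (prefix c v)                            ∎
    where open ≤-Reasoning
  unseparated : ∀ a b → a < b → b ≤ suc (suc m) → ∀ u v → u ∈ toList vs → v ∈ toList vs → isum a b u ≤ isum a b v + 1
  unseparated a b a<b _ u v u∈ v∈ = isum-≤ a b u v (<⇒≤ a<b) (bound (Chain-prefix-comparable moves u∈ v∈))
    where
    bound : (∀ c → prefix c u ≤ prefix c v) ⊎ (∀ c → prefix c v ≤ prefix c u) →
            prefix b u + prefix a v ≤ suc (prefix b v + prefix a u)
    bound (inj₁ u≤v) = ≤-trans (+-mono-≤ (u≤v b) (spread v∈ u∈ a)) (≤-reflexive (+-suc (prefix b v) (prefix a u)))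
    bound (inj₂ v≤u) = +-mono-≤ (spread u∈ v∈ b) (v≤u a)

-- The decorated matrix of a chain of moves

δ : ℕ → ℕ → ℕ
δ b c = if b ≡ᵇ c then 1 else 0

δ-refl : ∀ b → δ b b ≡ 1
δ-refl b rewrite ≡ᵇ-refl b = refl

-- markWord of a matrix whose only mark between rows a and a + 1 lies in column col a
module ColumnWord (col : ℕ → ℕ) (d i : ℕ) where

  mark : ℕ → ℕ → List ℕ
  mark b a = if b ≡ᵇ col a then suc a ∷ [] else []

  block : ℕ → List ℕ
  block b = concatMap (mark b) (upTo d)

  word : List ℕ
  word = concatMap block (upTo i)

  count : ℕ → ℕ → ℕ
  count b zero = 0
  count b (suc a) = count b a + δ b (col a)

  before : ℕ → ℕ
  before zero = 0
  before (suc b) = before b + count b d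

  length-mark : ∀ b a → length (mark b a) ≡ δ b (col a)
  length-mark b a with b ≡ᵇ col a
  ... | true = refl
  ... | false = refl

  length-marks : ∀ b a → length (concatMap (mark b) (upTo a)) ≡ count b a
  length-marks b zero = refl
  length-marks b (suc a) = begin
    length (concatMap (mark b) (upTo (suc a)))                 ≡⟨ cong length (concatMap-upTo-suc (mark b) a) ⟩
    length (concatMap (mark b) (upTo a) ++ mark b a)           ≡⟨ L.length-++ (concatMap (mark b) (upTo a)) ⟩
    length (concatMap (mark b) (upTo a)) + length (mark b a)   ≡⟨ cong₂ _+_ (length-marks b a) (length-mark b a) ⟩
    count b a + δ b (col a)                                    ∎
    where open ≡-Reasoning

  length-blocks : ∀ b → length (concatMap block (upTo b)) ≡ before b
  length-blocks zero = refl
  length-blocks (suc b) = begin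
    length (concatMap block (upTo (suc b)))                ≡⟨ cong length (concatMap-upTo-suc block b) ⟩
    length (concatMap block (upTo b) ++ block b)           ≡⟨ L.length-++ (concatMap block (upTo b)) ⟩
    length (concatMap block (upTo b)) + length (block b)   ≡⟨ cong₂ _+_ (length-blocks b) (length-marks b d) ⟩
    before b + count b d                                   ∎
    where open ≡-Reasoning

  count-< : ∀ a n → a < n → count (col a) a < count (col a) n
  count-< a (suc n) (s≤s a≤n) with m≤n⇒m<n∨m≡n a≤n
  ... | inj₁ a<n = ≤-trans (count-< a n a<n) (m≤m+n (count (col a) n) _)
  ... | inj₂ refl = ≤-reflexive (trans (+-comm 1 (count (col a) a)) (cong (count (col a) a +_) (sym (δ-refl (col a)))))

  nth-in-block : ∀ a n → a < n → nth (concatMap (mark (col a)) (upTo n)) (count (col a) a) ≡ suc a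
  nth-in-block a (suc n) (s≤s a≤n) rewrite concatMap-upTo-suc (mark (col a)) n with m≤n⇒m<n∨m≡n a≤n
  ... | inj₁ a<n = trans (nth-++ˡ (concatMap (mark (col a)) (upTo n)) (mark (col a) n) (count (col a) a)
                            (≤-trans (count-< a n a<n) (≤-reflexive (sym (length-marks (col a) n)))))
                         (nth-in-block a n a<n)
  ... | inj₂ refl = begin
    nth (concatMap (mark (col a)) (upTo a) ++ mark (col a) a) (count (col a) a)
      ≡⟨ cong (nth (concatMap (mark (col a)) (upTo a) ++ mark (col a) a)) (trans (sym (length-marks (col a) a)) (sym (+-identityʳ _))) ⟩
    nth (concatMap (mark (col a)) (upTo a) ++ mark (col a) a) (length (concatMap (mark (col a)) (upTo a)) + 0)
      ≡⟨ nth-++ʳ (concatMap (mark (col a)) (upTo a)) (mark (col a) a) 0 ⟩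
    nth (mark (col a) a) 0
      ≡⟨ mark-self ⟩
    suc a ∎
    where
    open ≡-Reasoning
    mark-self : nth (mark (col a) a) 0 ≡ suc a
    mark-self rewrite ≡ᵇ-refl (col a) = refl

  before-< : ∀ b n → b < n → before b + count b d ≤ before n
  before-< b (suc n) (s≤s b≤n) with m≤n⇒m<n∨m≡n b≤n
  ... | inj₁ b<n = ≤-trans (before-< b n b<n) (m≤m+n (before n) _)
  ... | inj₂ refl = ≤-refl

  nth-blocks : ∀ b k n → b < n → k < count b d → nth (concatMap block (upTo n)) (before b + k) ≡ nth (block b) k
  nth-blocks b k (suc n) (s≤s b≤n) k<count rewrite concatMap-upTo-suc block n with m≤n⇒m<n∨m≡n b≤n
  ... | inj₁ b<n = trans (nth-++ˡ (concatMap block (upTo n)) (block n) (before b + k)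
                            (≤-trans (+-monoʳ-< (before b) k<count) (≤-trans (before-< b n b<n) (≤-reflexive (sym (length-blocks n))))))
                         (nth-blocks b k n b<n k<count)
  ... | inj₂ refl = trans (cong (λ t → nth (concatMap block (upTo b) ++ block b) (t + k)) (sym (length-blocks b)))
                          (nth-++ʳ (concatMap block (upTo b)) (block b) k)

  nth-word : ∀ a → a < d → col a < i → nth word (before (col a) + count (col a) a) ≡ suc a
  nth-word a a<d col<i = trans (nth-blocks (col a) (count (col a) a) i col<i (count-< a d a<d)) (nth-in-block a d a<d)

  marks-below : ∀ a n → n ≤ col a → concatMap (λ b → mark b a) (upTo n) ≡ []
  marks-below a zero _ = refl
  marks-below a (suc n) n<col rewrite concatMap-upTo-suc (λ b → mark b a) n | marks-below a n (<⇒≤ n<col)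
                                    | ≢⇒≡ᵇ-false (<⇒≢ n<col) = refl

  marks-above : ∀ a n → col a < n → concatMap (λ b → mark b a) (upTo n) ≡ suc a ∷ []
  marks-above a (suc n) (s≤s col≤n) rewrite concatMap-upTo-suc (λ b → mark b a) n with m≤n⇒m<n∨m≡n col≤n
  ... | inj₁ col<n rewrite marks-above a n col<n | ≢⇒≡ᵇ-false (≢-sym (<⇒≢ col<n)) = refl
  ... | inj₂ refl rewrite marks-below a (col a) ≤-refl | ≡ᵇ-refl (col a) = refl

  word-↭ : (∀ a → a < d → col a < i) → word ↭ L.map suc (upTo d)
  word-↭ col<i = begin
    concatMap (λ b → concatMap (mark b) (upTo d)) (upTo i)     ↭⟨ concatMap-comm mark (upTo i) (upTo d) ⟩
    concatMap (λ a → concatMap (λ b → mark b a) (upTo i)) (upTo d)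
      ≡⟨ concatMap-upTo-cong _ _ d (λ a a<d → marks-above a i (col<i a a<d)) ⟩
    concatMap (λ a → suc a ∷ []) (upTo d)                       ≡⟨ L.concatMap-map (λ a → a ∷ []) suc (upTo d) ⟨
    concatMap (λ a → a ∷ []) (L.map suc (upTo d))               ≡⟨ L.concatMap-pure (L.map suc (upTo d)) ⟩
    L.map suc (upTo d)                                          ∎
    where open PermutationReasoning

length-positionsFrom : ∀ k bs → length (positionsFrom k bs) ≡ sum (L.map b2n bs)
length-positionsFrom k [] = refl
length-positionsFrom k (true ∷ bs) = cong suc (length-positionsFrom (suc k) bs)
length-positionsFrom k (false ∷ bs) = length-positionsFrom (suc k) bs

positionsFrom-++ : ∀ k xs ys → positionsFrom k (xs ++ ys) ≡ positionsFrom k xs ++ positionsFrom (k + length xs) ys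
positionsFrom-++ k [] ys = cong (λ t → positionsFrom t ys) (sym (+-identityʳ k))
positionsFrom-++ k (true ∷ xs) ys =
  cong (suc k ∷_) (trans (positionsFrom-++ (suc k) xs ys) (cong (λ t → positionsFrom (suc k) xs ++ positionsFrom t ys) (sym (+-suc k _))))
positionsFrom-++ k (false ∷ xs) ys =
  trans (positionsFrom-++ (suc k) xs ys) (cong (λ t → positionsFrom (suc k) xs ++ positionsFrom t ys) (sym (+-suc k _)))

positions-1z0 : ∀ {m} (z : Pt m) → positions (true ∷ (z ∷ʳ false)) ≡ 1 ∷ positionsFrom 1 (toList z)
positions-1z0 z = cong (1 ∷_) (trans (cong (positionsFrom 1) (V.toList-∷ʳ false z))
                                     (trans (positionsFrom-++ 1 (toList z) (false ∷ [])) (L.++-identityʳ _)))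

positions-0z1 : ∀ {m} (z : Pt m) → ∃ λ k → positions (false ∷ (z ∷ʳ true)) ≡ positionsFrom 1 (toList z) L.∷ʳ k
positions-0z1 z = _ , trans (cong (positionsFrom 1) (V.toList-∷ʳ true z)) (positionsFrom-++ 1 (toList z) (true ∷ []))

length-positions : (v : Pt n) → length (positions v) ≡ weight v
length-positions v = length-positionsFrom 0 (toList v)

-- In Move u v q the one at coordinate q of v is its (prefix q v)-th one, and
-- moving it to coordinate q + 1 adds one to exactly that position.
Move-position : ∀ {u v : Pt (suc n)} {q} → Move u v q → ∀ k → nth (positionsFrom k (toList v)) (prefix (toℕ q) v) ≡ k + suc (toℕ q)
Move-position here k = +-comm 1 k
Move-position (there {b = false} {p = p} move) k = trans (Move-position move (suc k)) (sym (+-suc k (suc (toℕ p))))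
Move-position (there {b = true} {p = p} move) k = trans (Move-position move (suc k)) (sym (+-suc k (suc (toℕ p))))

Move-positions : ∀ {u v : Pt (suc n)} {q} → Move u v q → ∀ k b →
                 nth (positionsFrom k (toList u)) b ≡ nth (positionsFrom k (toList v)) b + δ b (prefix (toℕ q) v)
Move-positions here k zero = +-comm 1 (suc k)
Move-positions here k (suc b) = sym (+-identityʳ _)
Move-positions (there {b = false} move) k b = Move-positions move (suc k) b
Move-positions (there {b = true} move) k zero = sym (+-identityʳ _)
Move-positions (there {b = true} move) k (suc b) = Move-positions move (suc k) b

Move-prefix-< : ∀ {u v : Pt (suc n)} {q} → Move u v q → prefix (toℕ q) v < weight v
Move-prefix-< here = s≤s z≤n
Move-prefix-< (there {b = false} move) = Move-prefix-< move
Move-prefix-< (there {b = true} move) = s≤s (Move-prefix-< move)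

nthL-last : (R : Vec (Pt n) (suc k)) → nthL (L.map positions (toList R)) k ≡ positions (last′ R)
nthL-last (x ∷ []) = refl
nthL-last (x ∷ y ∷ R) = nthL-last (y ∷ R)

-- In a chain read downwards (each row a move away from the next), the one
-- moving between rows a and a + 1 sits in column (column R qs a) of the
-- matrix of positions.
column : Vec (Pt (suc n)) (suc k) → Vec (Fin n) k → ℕ → ℕ
column (u ∷ _ ∷ _) (q ∷ _) zero = prefix (toℕ q) u
column (_ ∷ v ∷ vs) (_ ∷ qs) (suc a) = column (v ∷ vs) qs a
column (_ ∷ []) [] _ = 0

label : Vec (Fin n) k → ℕ → ℕ
label qs a = nth (toList (V.map toℕ qs)) a

label-lookup : ∀ (qs : Vec (Fin n) k) a → label qs (toℕ a) ≡ toℕ (lookup qs a)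
label-lookup (q ∷ qs) zero = refl
label-lookup (q ∷ qs) (suc a) = label-lookup qs a

Chain-entry-suc : ∀ {R : Vec (Pt (suc n)) (suc k)} {qs} → Chain (flip Move) R qs →
                  ∀ a → a < k → ∀ b → entry R (suc a) b ≡ entry R a b + δ b (column R qs a)
Chain-entry-suc [ _ ] _ () _
Chain-entry-suc (move ∷ _) zero _ b = Move-positions move 0 b
Chain-entry-suc (_ ∷ moves) (suc a) (s≤s a<k) b = Chain-entry-suc moves a a<k b

Chain-entry-column : ∀ {R : Vec (Pt (suc n)) (suc k)} {qs} → Chain (flip Move) R qs →
                     ∀ a → a < k → entry R a (column R qs a) ≡ suc (label qs a)
Chain-entry-column [ _ ] _ ()
Chain-entry-column (move ∷ _) zero _ = Move-position move 0
Chain-entry-column (_ ∷ moves) (suc a) (s≤s a<k) = Chain-entry-column moves a a<k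

Chain-column-< : ∀ {R : Vec (Pt (suc n)) (suc k)} {qs} → Chain (flip Move) R qs →
                 ∀ a → a < k → column R qs a < weight (V.head R)
Chain-column-< [ _ ] _ ()
Chain-column-< (move ∷ _) zero _ = Move-prefix-< move
Chain-column-< (move ∷ moves) (suc a) (s≤s a<k) = ≤-trans (Chain-column-< moves a a<k) (≤-reflexive (Move-weight move))

<ᵇ-+δ : ∀ x b c → (x <ᵇ x + δ b c) ≡ (b ≡ᵇ c)
<ᵇ-+δ x b c with b ≡ᵇ c
... | true = <ᵇ-true (≤-reflexive (+-comm 1 x))
... | false = <ᵇ-false (≤-reflexive (+-identityʳ x))

entry-zero : ∀ (R : Vec (Pt n) (suc k)) b → entry R 0 b ≡ nth (positions (V.head R)) b
entry-zero (x ∷ R) b = refl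

entry-last : ∀ (R : Vec (Pt n) (suc k)) b → entry R k b ≡ nth (positions (last′ R)) b
entry-last R b = cong (λ ps → nth ps b) (nthL-last R)

module DecoratedMatrix {m i} {R : Vec (Pt (suc (suc m))) (suc (suc m))} {qs : Vec (Fin (suc m)) (suc m)}
  (moves : Chain (flip Move) R qs) {z : Pt m} (top : V.head R ≡ true ∷ (z ∷ʳ false)) (bottom : last′ R ≡ false ∷ (z ∷ʳ true))
  (weight≡i : weight (V.head R) ≡ i) where

  d : ℕ
  d = suc m

  col : ℕ → ℕ
  col = column R qs

  open ColumnWord col d i

  markWord≡word : markWord d i R ≡ word
  markWord≡word = concatMap-upTo-cong _ _ i λ b _ → concatMap-upTo-cong _ _ d λ a a<d →
    cong (λ t → if t then suc a ∷ [] else [])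
         (trans (cong (entry R a b <ᵇ_) (Chain-entry-suc moves a a<d b)) (<ᵇ-+δ (entry R a b) b (col a)))

  entry-count : ∀ a → a ≤ d → ∀ b → entry R a b ≡ entry R 0 b + count b a
  entry-count zero _ b = sym (+-identityʳ _)
  entry-count (suc a) a<d b = begin
    entry R (suc a) b                        ≡⟨ Chain-entry-suc moves a a<d b ⟩
    entry R a b + δ b (col a)                ≡⟨ cong (_+ δ b (col a)) (entry-count a (<⇒≤ a<d) b) ⟩
    entry R 0 b + count b a + δ b (col a)    ≡⟨ +-assoc (entry R 0 b) (count b a) _ ⟩
    entry R 0 b + count b (suc a)            ∎
    where open ≡-Reasoning

  col-< : ∀ a → a < d → col a < i
  col-< a a<d = subst (col a <_) weight≡i (Chain-column-< moves a a<d)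

  Q : List ℕ
  Q = positionsFrom 1 (toList z)

  positions-top : positions (V.head R) ≡ 1 ∷ Q
  positions-top = trans (cong positions top) (positions-1z0 z)

  length-Q : suc (length Q) ≡ i
  length-Q = trans (cong length (sym positions-top)) (trans (length-positions (V.head R)) weight≡i)

  -- the bottom row 0z1 is the top row 1z0 shifted one column to the left
  entry-wrap : ∀ b → suc b < i → entry R d b ≡ entry R 0 (suc b)
  entry-wrap b b+1<i = begin
    entry R d b                              ≡⟨ entry-last R b ⟩
    nth (positions (last′ R)) b              ≡⟨ cong (λ v → nth (positions v) b) bottom ⟩
    nth (positions (false ∷ (z ∷ʳ true))) b  ≡⟨ cong (λ ps → nth ps b) (proj₂ (positions-0z1 z)) ⟩
    nth (Q L.∷ʳ _) b                         ≡⟨ nth-++ˡ Q _ b (≤-pred (subst (suc b <_) (sym length-Q) b+1<i)) ⟩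
    nth Q b                                  ≡⟨ cong (λ ps → nth ps (suc b)) positions-top ⟨
    nth (positions (V.head R)) (suc b)       ≡⟨ entry-zero R (suc b) ⟨
    entry R 0 (suc b)                        ∎
    where open ≡-Reasoning

  entry-top : ∀ b → b < i → entry R 0 b ≡ suc (before b)
  entry-top zero _ = trans (entry-zero R 0) (cong (λ ps → nth ps 0) positions-top)
  entry-top (suc b) b+1<i = begin
    entry R 0 (suc b)               ≡⟨ entry-wrap b b+1<i ⟨
    entry R d b                     ≡⟨ entry-count d ≤-refl b ⟩
    entry R 0 b + count b d         ≡⟨ cong (_+ count b d) (entry-top b (<⇒≤ b+1<i)) ⟩
    suc (before b + count b d)      ∎
    where open ≡-Reasoning

  label≡ : ∀ a → a < d → label qs a ≡ before (col a) + count (col a) a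
  label≡ a a<d = suc-injective (begin
    suc (label qs a)                          ≡⟨ Chain-entry-column moves a a<d ⟨
    entry R a (col a)                         ≡⟨ entry-count a (<⇒≤ a<d) (col a) ⟩
    entry R 0 (col a) + count (col a) a       ≡⟨ cong (_+ count (col a) a) (entry-top (col a) (col-< a a<d)) ⟩
    suc (before (col a) + count (col a) a)    ∎)
    where open ≡-Reasoning

  markWord-label : ∀ a → a < d → nth (markWord d i R) (label qs a) ≡ suc a
  markWord-label a a<d = trans (cong₂ nth markWord≡word (label≡ a a<d)) (nth-word a a<d (col-< a a<d))

  markWord-at-label : ∀ (a : Fin d) → nth (markWord d i R) (toℕ (lookup qs a)) ≡ suc (toℕ a)
  markWord-at-label a = trans (cong (nth (markWord d i R)) (sym (label-lookup qs a))) (markWord-label (toℕ a) (Fin.toℕ<n a))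

  markWord-↭ : markWord d i R ↭ L.map suc (upTo d)
  markWord-↭ = subst (_↭ L.map suc (upTo d)) (sym markWord≡word) (word-↭ col-<)

  sorted : Sorted d i R
  sorted = (λ a b a<d _ → ≤-trans (m≤m+n _ _) (≤-reflexive (sym (Chain-entry-suc moves a a<d b)))) ,
           (λ b b+1<i → ≤-reflexive (entry-wrap b b+1<i))

-- Uniqueness of the decorated matrix

increasing-Linked : ∀ {vs : Vec (Pt n) k} → StrictlyIncreasing vs → Linked _<lex_ (toList vs)
increasing-Linked [] = []
increasing-Linked [ u ] = [-]
increasing-Linked (u<v ∷ vs↑) = u<v ∷ increasing-Linked vs↑

increasing-unique : ∀ {vs : Vec (Pt n) k} → StrictlyIncreasing vs → Unique (toList vs)
increasing-unique vs↑ = AllPairs.map (λ u<v u≡v → <lex-irrefl u≡v u<v) (Linked⇒AllPairs <lex-trans (increasing-Linked vs↑))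

Chain-decreasing : ∀ {xs : Vec (Pt (suc n)) (suc k)} {qs} → Chain (flip Move) xs qs → Linked (flip _<lex_) (toList xs)
Chain-decreasing [ x ] = [-]
Chain-decreasing (move ∷ moves) = Move-<lex move ∷ Chain-decreasing moves

positionsFrom-head : ∀ k xs → 0 < length (positionsFrom k xs) → suc k ≤ nth (positionsFrom k xs) 0
positionsFrom-head k (true ∷ xs) _ = ≤-refl
positionsFrom-head k (false ∷ xs) 0<len = ≤-trans (n≤1+n (suc k)) (positionsFrom-head (suc k) xs 0<len)

positions-≤⇒≥lex : ∀ (u v : Pt n) k → length (positionsFrom k (toList u)) ≡ length (positionsFrom k (toList v)) →
                   (∀ b → b < length (positionsFrom k (toList u)) →
                          nth (positionsFrom k (toList u)) b ≤ nth (positionsFrom k (toList v)) b) →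
                   u ≡ v ⊎ v <lex u
positions-≤⇒≥lex [] [] k _ _ = inj₁ refl
positions-≤⇒≥lex (true ∷ u) (true ∷ v) k same-length u≤v
  with positions-≤⇒≥lex u v (suc k) (suc-injective same-length) (λ b b<len → u≤v (suc b) (s≤s b<len))
... | inj₁ u≡v = inj₁ (cong (true ∷_) u≡v)
... | inj₂ v<u = inj₂ (there v<u)
positions-≤⇒≥lex (false ∷ u) (false ∷ v) k same-length u≤v with positions-≤⇒≥lex u v (suc k) same-length u≤v
... | inj₁ u≡v = inj₁ (cong (false ∷_) u≡v)
... | inj₂ v<u = inj₂ (there v<u)
positions-≤⇒≥lex (true ∷ u) (false ∷ v) k _ _ = inj₂ here
positions-≤⇒≥lex (false ∷ u) (true ∷ v) k same-length u≤v =
  ⊥-elim (<-irrefl refl (≤-trans (positionsFrom-head (suc k) (toList u) 0<len) (u≤v 0 0<len)))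
  where
  0<len : 0 < length (positionsFrom (suc k) (toList u))
  0<len = subst (0 <_) (sym same-length) (s≤s z≤n)

columns-increasing⇒decreasing : ∀ {i} (R : Vec (Pt n) (suc k)) → (∀ a b → a < k → b < i → entry R a b ≤ entry R (suc a) b) →
                                All (λ v → weight v ≡ i) (toList R) → Unique (toList R) → Linked (flip _<lex_) (toList R)
columns-increasing⇒decreasing (x ∷ []) _ _ _ = [-]
columns-increasing⇒decreasing {i = i} (x ∷ y ∷ R) columns↑ (wx ∷ wy ∷ ws) ((x≢y ∷ _) ∷ distinct)
  with positions-≤⇒≥lex x y 0 same-length (λ b b<len → columns↑ 0 b (s≤s z≤n) (subst (b <_) (trans (length-positions x) wx) b<len))
  where
  same-length : length (positions x) ≡ length (positions y)
  same-length = trans (length-positions x) (trans wx (sym (trans (length-positions y) wy)))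
... | inj₁ x≡y = ⊥-elim (x≢y x≡y)
... | inj₂ y<x = y<x ∷ columns-increasing⇒decreasing (y ∷ R) (λ a b a<k → columns↑ (suc a) b (s≤s a<k)) (wy ∷ ws) distinct

sorted-unique : ∀ {d i} {vs R : Vec (Pt (suc d)) (suc d)} {ps} → Chain Move vs ps → All (λ v → weight v ≡ i) (toList vs) →
                toList R ↭ toList vs → Sorted d i R → R ≡ V.reverse vs
sorted-unique {vs = vs} {R} moves weights R↭vs (columns↑ , _) = toList-injective R (V.reverse vs)
  (Linked-↭⇒≡ (flip <lex-trans) (λ eq → <lex-irrefl (sym eq))
    (columns-increasing⇒decreasing R columns↑ (All-resp-↭ (↭-sym R↭vs) weights)
       (Unique-resp-↭ (↭-sym R↭vs) (increasing-unique (Chain-increasing moves))))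
    (Chain-decreasing (Chain-reverse moves))
    (↭-trans R↭vs (↭-sym (toList-reverse-↭ vs))))

SameAt : Fin n → Vec (Pt n) k → Vec (Pt n) k → Set
SameAt j = Pointwise (λ u u′ → lookup u j ≡ lookup u′ j)

Chain-sameAt-below : ∀ {R R′ : Vec (Pt (suc n)) (suc k)} {qs} → Chain (flip Move) R qs → Chain (flip Move) R′ qs →
                     ∀ j → lookup (V.head R) j ≡ lookup (V.head R′) j → SameAt j R R′
Chain-sameAt-below [ _ ] [ _ ] j same = same ∷ []
Chain-sameAt-below (move ∷ moves) (move′ ∷ moves′) j same =
  same ∷ Chain-sameAt-below moves moves′ j (proj₂ (Move-coordinate move move′ j) same)

-- at a move with label p both rows are pinned down in coordinates p and p + 1;
-- from there agreement spreads to all rows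
Chain-sameAt-label : ∀ {R R′ : Vec (Pt (suc n)) (suc k)} {qs} → Chain (flip Move) R qs → Chain (flip Move) R′ qs →
                     ∀ {p} → p ∈ᵥ qs → SameAt (inject₁ p) R R′ × SameAt (suc p) R R′
Chain-sameAt-label moves@(move ∷ _) moves′@(move′ ∷ _) (here refl) =
  Chain-sameAt-below moves moves′ _ (trans (proj₁ (Move-target move)) (sym (proj₁ (Move-target move′)))) ,
  Chain-sameAt-below moves moves′ _ (trans (proj₂ (Move-target move)) (sym (proj₂ (Move-target move′))))
Chain-sameAt-label (move ∷ moves) (move′ ∷ moves′) (there p∈) with Chain-sameAt-label moves moves′ p∈
... | same₁@(e₁ ∷ _) , same₂@(e₂ ∷ _) =
  proj₁ (Move-coordinate move move′ _) e₁ ∷ same₁ , proj₁ (Move-coordinate move move′ _) e₂ ∷ same₂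

Chain-determined : ∀ {m} {R R′ : Vec (Pt (suc (suc m))) (suc k)} {qs} → Chain (flip Move) R qs → Chain (flip Move) R′ qs →
                   (∀ p → p ∈ᵥ qs) → R ≡ R′
Chain-determined {m = m} {R = R} {R′} moves moves′ every = Pointwise-≡⇒≡ (rows R R′ sameAt)
  where
  sameAt : ∀ j → SameAt j R R′
  sameAt zero = proj₁ (Chain-sameAt-label moves moves′ (every zero))
  sameAt (suc j) = proj₂ (Chain-sameAt-label moves moves′ (every j))
  rows : ∀ {k} (S S′ : Vec (Pt (suc (suc m))) k) → (∀ j → SameAt j S S′) → Pointwise _≡_ S S′
  rows [] [] _ = []
  rows (u ∷ S) (u′ ∷ S′) same = lookup-ext u u′ (λ j → Pointwise.head (same j)) ∷ rows S S′ (λ j → Pointwise.tail (same j))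

-- The chain of moves of a permutation

-- Whether, after the moves 1, …, a, a coordinate holds a one, given the move
-- that brings a one in (arrival) and the one that takes it away (departure);
-- if the departure comes first, the coordinate starts with a one.
occupied : (a arrival departure : ℕ) → Bool
occupied a arr dep = if dep <ᵇ arr then (a <ᵇ dep) ∨ (arr <ᵇ suc a) else (arr <ᵇ suc a) ∧ (a <ᵇ dep)

occupied-stable : ∀ a arr dep → arr ≢ suc a → dep ≢ suc a → occupied (suc a) arr dep ≡ occupied a arr dep
occupied-stable a arr dep arr≢ dep≢ = cong₂ (λ x y → if dep <ᵇ arr then x ∨ y else y ∧ x) (before dep dep≢) (after arr arr≢)
  where
  before : ∀ t → t ≢ suc a → (suc a <ᵇ t) ≡ (a <ᵇ t)
  before t t≢ with <-cmp a t
  ... | tri< a<t _ _ = trans (<ᵇ-true (≤∧≢⇒< a<t (t≢ ∘ sym))) (sym (<ᵇ-true a<t))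
  ... | tri≈ _ refl _ = trans (<ᵇ-false (n≤1+n a)) (sym (<ᵇ-false {a} {a} ≤-refl))
  ... | tri> _ _ t<a = trans (<ᵇ-false (m≤n⇒m≤1+n (<⇒≤ t<a))) (sym (<ᵇ-false (<⇒≤ t<a)))
  after : ∀ u → u ≢ suc a → (u <ᵇ suc (suc a)) ≡ (u <ᵇ suc a)
  after u u≢ with <-cmp u (suc a)
  ... | tri< u<a _ _ = trans (<ᵇ-true (m<n⇒m<1+n u<a)) (sym (<ᵇ-true u<a))
  ... | tri≈ _ u≡ _ = ⊥-elim (u≢ u≡)
  ... | tri> _ _ a<u = trans (<ᵇ-false a<u) (sym (<ᵇ-false (<⇒≤ a<u)))

occupied-departure : ∀ a arr → arr ≢ suc a → occupied a arr (suc a) ≡ true × occupied (suc a) arr (suc a) ≡ false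
occupied-departure a arr arr≢ rewrite <ᵇ-true (n<1+n a) | <ᵇ-false {suc a} ≤-refl with <-cmp (suc a) arr
... | tri< a<arr _ _ rewrite <ᵇ-true a<arr | <ᵇ-false {arr} {suc (suc a)} a<arr = refl , refl
... | tri≈ _ a≡arr _ = ⊥-elim (arr≢ (sym a≡arr))
... | tri> _ _ arr<a rewrite <ᵇ-false (<⇒≤ arr<a) | <ᵇ-true arr<a | <ᵇ-true (m<n⇒m<1+n arr<a) = refl , refl

occupied-arrival : ∀ a dep → dep ≢ suc a → occupied a (suc a) dep ≡ false × occupied (suc a) (suc a) dep ≡ true
occupied-arrival a dep dep≢ rewrite <ᵇ-false {suc a} ≤-refl | <ᵇ-true (n<1+n (suc a)) with <-cmp dep (suc a)
... | tri< dep<a _ _ rewrite <ᵇ-true dep<a | <ᵇ-false {a} (≤-pred dep<a) | <ᵇ-false {suc a} (<⇒≤ dep<a) = refl , refl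
... | tri≈ _ dep≡a _ = ⊥-elim (dep≢ dep≡a)
... | tri> _ _ a<dep rewrite <ᵇ-false (<⇒≤ a<dep) | <ᵇ-true a<dep = refl , refl

occupied-start : ∀ {arr dep} → 1 ≤ arr → 1 ≤ dep → occupied 0 arr dep ≡ (dep <ᵇ arr)
occupied-start {arr} {dep} 1≤arr 1≤dep rewrite <ᵇ-true 1≤dep | <ᵇ-false {arr} {1} 1≤arr with dep <ᵇ arr
... | true = refl
... | false = refl

occupied-end : ∀ {d arr dep} → arr ≤ d → dep ≤ d → occupied d arr dep ≡ (dep <ᵇ arr)
occupied-end {d} {arr} {dep} arr≤d dep≤d rewrite <ᵇ-false {d} dep≤d | <ᵇ-true (s≤s arr≤d) with dep <ᵇ arr
... | true = refl
... | false = refl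

descents-weight : ∀ m (w : List ℕ) → length w ≡ suc m →
                  weight (tabulate {n = m} (λ j → nth w (suc (toℕ j)) <ᵇ nth w (toℕ j))) ≡ descents w
descents-weight zero (x ∷ []) _ = refl
descents-weight (suc m) (x ∷ y ∷ w) same-length =
  cong₂ _+_ (b2n-if (y <ᵇ x)) (descents-weight m (y ∷ w) (suc-injective same-length))
  where
  b2n-if : ∀ b → b2n b ≡ (if b then 1 else 0)
  b2n-if true = refl
  b2n-if false = refl

module Rows (m : ℕ) {w : List ℕ} (w↭ : w ↭ L.map suc (upTo (suc m))) where

  d : ℕ
  d = suc m

  length-w : length w ≡ d
  length-w = trans (↭-length w↭) (trans (L.length-map suc (upTo d)) (L.length-upTo d))

  unique-w : Unique w
  unique-w = Unique-resp-↭ (↭-sym w↭) (Unique.map⁺ suc-injective (Unique.upTo⁺ d))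

  letter-range : ∀ j → j < d → 1 ≤ nth w j × nth w j ≤ d
  letter-range j j<d with ∈.∈-map⁻ suc (∈-resp-↭ w↭ (nth-∈ w j (subst (j <_) (sym length-w) j<d)))
  ... | a , a∈ , eq rewrite eq = s≤s z≤n , ∈.∈-upTo⁻ a∈

  letter-∈ : (a : Fin d) → suc (toℕ a) ∈ w
  letter-∈ a = ∈-resp-↭ (↭-sym w↭) (∈.∈-map⁺ suc (∈.∈-upTo⁺ (Fin.toℕ<n a)))

  -- the position in w of the letter a + 1
  position : Fin d → Fin d
  position a = Fin.cast length-w (Any.index (letter-∈ a))

  nth-position : ∀ a → nth w (toℕ (position a)) ≡ suc (toℕ a)
  nth-position a = begin
    nth w (toℕ (position a))                       ≡⟨ cong (nth w) (Fin.toℕ-cast length-w _) ⟩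
    nth w (toℕ (Any.index (letter-∈ a)))           ≡⟨ nth-lookup w _ ⟩
    L.lookup w (Any.index (letter-∈ a))            ≡⟨ Any.lookup-index (letter-∈ a) ⟨
    suc (toℕ a)                                    ∎
    where open ≡-Reasoning

  position-unique : ∀ a j → nth w j ≡ suc (toℕ a) → j ≡ toℕ (position a)
  position-unique a j eq with j <? d
  ... | yes j<d = nth-injective unique-w (subst (j <_) (sym length-w) j<d)
                    (subst (toℕ (position a) <_) (sym length-w) (Fin.toℕ<n (position a))) (trans eq (sym (nth-position a)))
  ... | no j≮d = ⊥-elim (0≢1+n (trans (sym (nth-beyond w j (subst (_≤ j) (sym length-w) (≮⇒≥ j≮d)))) eq))

  position-onto : ∀ p → ∃ λ a → position a ≡ p
  position-onto p with letter-range (toℕ p) (Fin.toℕ<n p)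
  ... | 1≤x , x≤d with nth w (toℕ p) in eq
  ...   | suc a = fromℕ< x≤d ,
                  Fin.toℕ-injective (sym (position-unique (fromℕ< x≤d) (toℕ p) (trans eq (cong suc (sym (Fin.toℕ-fromℕ< x≤d))))))

  labels : Vec (Fin d) d
  labels = tabulate position

  labels-unique : Vecᵘ.Unique labels
  labels-unique = Vecᵘ.tabulate⁺ λ {a} {b} eq →
    Fin.toℕ-injective (suc-injective (trans (sym (nth-position a)) (trans (cong (nth w ∘ toℕ) eq) (nth-position b))))

  labels-cover : ∀ p → p ∈ᵥ labels
  labels-cover p with position-onto p
  ... | a , refl = ∈ᵥ.∈-tabulate⁺ position a

  -- The one in coordinate j arrives with the move of the letter w_{j-1} and
  -- leaves with that of w_j; nth's junk value 0 stands for "never".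
  arrival departure : ℕ → ℕ
  arrival j = nth (0 ∷ w) j
  departure j = nth w j

  coordinate : ℕ → Fin (suc d) → Bool
  coordinate a j = occupied a (arrival (toℕ j)) (departure (toℕ j))

  row : ℕ → Pt (suc d)
  row a = tabulate (coordinate a)

  departure-≢ : ∀ a j → j ≢ toℕ (position a) → departure j ≢ suc (toℕ a)
  departure-≢ a j j≢ eq = j≢ (position-unique a j eq)

  arrival-≢ : ∀ a j → j ≢ suc (toℕ (position a)) → arrival j ≢ suc (toℕ a)
  arrival-≢ a zero _ ()
  arrival-≢ a (suc j) j≢ = departure-≢ a j (j≢ ∘ cong suc)

  row-move : ∀ a → Move (row (suc (toℕ a))) (row (toℕ a)) (position a)
  row-move a = Move-intro (row (suc a′)) (row a′) q
    (trans (at-q (suc a′)) (proj₂ leave)) (trans (at-q+1 (suc a′)) (proj₂ arrive))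
    (trans (at-q a′) (proj₁ leave)) (trans (at-q+1 a′) (proj₁ arrive))
    (λ j j≢q j≢q+1 → trans (V.lookup∘tabulate (coordinate (suc a′)) j)
       (trans (occupied-stable a′ _ _ (arrival-≢ a (toℕ j) j≢q+1) (departure-≢ a (toℕ j) j≢q))
              (sym (V.lookup∘tabulate (coordinate a′) j))))
    where
    a′ : ℕ
    a′ = toℕ a
    q : Fin d
    q = position a
    leave : occupied a′ (arrival (toℕ q)) (suc a′) ≡ true × occupied (suc a′) (arrival (toℕ q)) (suc a′) ≡ false
    leave = occupied-departure a′ (arrival (toℕ q)) (arrival-≢ a (toℕ q) (1+n≢n ∘ sym))
    arrive : occupied a′ (suc a′) (departure (suc (toℕ q))) ≡ false × occupied (suc a′) (suc a′) (departure (suc (toℕ q))) ≡ true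
    arrive = occupied-arrival a′ (departure (suc (toℕ q))) (departure-≢ a (suc (toℕ q)) 1+n≢n)
    at-q : ∀ b → lookup (row b) (inject₁ q) ≡ occupied b (arrival (toℕ q)) (suc a′)
    at-q b = trans (V.lookup∘tabulate (coordinate b) (inject₁ q))
                   (trans (cong (λ j → occupied b (arrival j) (departure j)) (Fin.toℕ-inject₁ q))
                          (cong (occupied b (arrival (toℕ q))) (nth-position a)))
    at-q+1 : ∀ b → lookup (row b) (suc q) ≡ occupied b (suc a′) (departure (suc (toℕ q)))
    at-q+1 b = trans (V.lookup∘tabulate (coordinate b) (suc q))
                     (cong (λ x → occupied b x (departure (suc (toℕ q)))) (nth-position a))

  rows : Vec (Pt (suc d)) (suc d)
  rows = tabulate (row ∘ toℕ)

  rows-chain : Chain (flip Move) rows labels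
  rows-chain = Chain-tabulate (row ∘ toℕ) position λ a →
    subst (λ r → Move (row (suc (toℕ a))) r (position a)) (cong row (sym (Fin.toℕ-inject₁ a))) (row-move a)

  descentVector : Pt m
  descentVector = tabulate (λ j → nth w (suc (toℕ j)) <ᵇ nth w (toℕ j))

  row-shape : ∀ a {x y} → occupied a 0 (nth w 0) ≡ x →
              (∀ (j : Fin m) → occupied a (nth w (toℕ j)) (nth w (suc (toℕ j))) ≡ (nth w (suc (toℕ j)) <ᵇ nth w (toℕ j))) →
              occupied a (nth w m) 0 ≡ y → row a ≡ x ∷ (descentVector ∷ʳ y)
  row-shape a {x} {y} first middle final =
    cong₂ _∷_ first (trans (tabulate-∷ʳ (coordinate a ∘ suc))
                           (cong₂ _∷ʳ_ (V.tabulate-cong inner) last))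
    where
    inner : ∀ j → occupied a (nth w (toℕ (inject₁ j))) (nth w (suc (toℕ (inject₁ j)))) ≡ (nth w (suc (toℕ j)) <ᵇ nth w (toℕ j))
    inner j rewrite Fin.toℕ-inject₁ j = middle j
    last : occupied a (nth w (toℕ (fromℕ m))) (nth w (suc (toℕ (fromℕ m)))) ≡ y
    last rewrite Fin.toℕ-fromℕ m | nth-beyond w d (≤-reflexive length-w) = final

  letter-≥1 : ∀ j → j < d → 1 ≤ nth w j
  letter-≥1 j j<d = proj₁ (letter-range j j<d)

  letter-≤d : ∀ j → j < d → nth w j ≤ d
  letter-≤d j j<d = proj₂ (letter-range j j<d)

  row-zero : row 0 ≡ true ∷ (descentVector ∷ʳ false)
  row-zero = row-shape 0 (<ᵇ-true (letter-≥1 0 (s≤s z≤n)))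
    (λ j → occupied-start (letter-≥1 (toℕ j) (m<n⇒m<1+n (Fin.toℕ<n j))) (letter-≥1 (suc (toℕ j)) (s≤s (Fin.toℕ<n j))))
    (occupied-never (letter-≥1 m ≤-refl))
    where
    occupied-never : ∀ {arr} → 1 ≤ arr → occupied 0 arr 0 ≡ false
    occupied-never {arr} 1≤arr rewrite <ᵇ-false {arr} {1} 1≤arr with 0 <ᵇ arr
    ... | true = refl
    ... | false = refl

  row-final : row d ≡ false ∷ (descentVector ∷ʳ true)
  row-final = row-shape d (occupied-end z≤n (letter-≤d 0 (s≤s z≤n)))
    (λ j → occupied-end (letter-≤d (toℕ j) (m<n⇒m<1+n (Fin.toℕ<n j))) (letter-≤d (suc (toℕ j)) (s≤s (Fin.toℕ<n j))))
    (trans (occupied-end (letter-≤d m ≤-refl) z≤n) (<ᵇ-true (letter-≥1 m ≤-refl)))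

  rows-last : last′ rows ≡ false ∷ (descentVector ∷ʳ true)
  rows-last = trans (last′-tabulate (row ∘ toℕ)) (trans (cong row (Fin.toℕ-fromℕ d)) row-final)

  weight-row-zero : weight (row 0) ≡ suc (descents w)
  weight-row-zero = trans (cong weight row-zero)
    (cong suc (trans (weight-∷ʳ descentVector false) (trans (+-identityʳ _) (descents-weight m w length-w))))

  labels-determined : ∀ (qs : Vec (Fin d) d) → (∀ a → nth w (toℕ (lookup qs a)) ≡ suc (toℕ a)) → qs ≡ labels
  labels-determined qs spec = lookup-ext qs labels λ a →
    trans (Fin.toℕ-injective (position-unique a _ (spec a))) (sym (V.lookup∘tabulate position a))

  word-determined : ∀ (σ : List ℕ) → length σ ≡ d → (∀ a → nth σ (toℕ (position a)) ≡ suc (toℕ a)) → σ ≡ w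
  word-determined σ length-σ spec = nth-ext σ w (trans length-σ (sym length-w)) λ j j<len →
    let j<d = subst (j <_) length-σ j<len
        (a , eq) = position-onto (fromℕ< j<d)
        j≡ = trans (sym (Fin.toℕ-fromℕ< j<d)) (cong toℕ (sym eq))
    in begin
      nth σ j                      ≡⟨ cong (nth σ) j≡ ⟩
      nth σ (toℕ (position a))     ≡⟨ spec a ⟩
      suc (toℕ a)                  ≡⟨ nth-position a ⟨
      nth w (toℕ (position a))     ≡⟨ cong (nth w) j≡ ⟨
      nth w j                      ∎
    where open ≡-Reasoning

-- The bijection

module AlcoveWord {m i} (A : Alcove (suc m) i) where

  open Alcove A
  open MoveChain (alcove-moveChain A)

  d : ℕ
  d = suc m

  rows : Vec (Pt (suc d)) (suc d)
  rows = V.reverse verts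

  rows-chain : Chain (flip Move) rows (V.reverse labels)
  rows-chain = Chain-reverse moves

  weight-top : weight (V.head rows) ≡ i
  weight-top = trans (cong weight (head-reverse verts)) (All.lookup inΔ (last′-∈ verts))

  open DecoratedMatrix rows-chain (trans (head-reverse verts) ends) (trans (last′-reverse verts) starts) weight-top
    using (sorted; markWord-↭; markWord-at-label)

  σ : List ℕ
  σ = markWord d i rows

  sigma : SigmaOf A σ
  sigma = rows , toList-reverse-↭ verts , sorted , refl

  sigma-unique : ∀ w → SigmaOf A w → w ≡ σ
  sigma-unique w (R , R↭verts , R-sorted , refl) = cong (markWord d i) (sorted-unique moves inΔ R↭verts R-sorted)

  σ↭ : σ ↭ L.map suc (upTo d)
  σ↭ = markWord-↭

  module W = Rows m σ↭

  rows-determined : rows ≡ W.rows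
  rows-determined = Chain-determined rows-chain (subst (Chain (flip Move) W.rows) (sym labels≡) W.rows-chain)
                                     (λ p → subst (p ∈ᵥ_) (sym labels≡) (W.labels-cover p))
    where
    labels≡ : V.reverse labels ≡ W.labels
    labels≡ = W.labels-determined (V.reverse labels) markWord-at-label

  eulerian : Eulerian d i σ
  eulerian = σ↭ , sym (cong pred (begin
    i                       ≡⟨ weight-top ⟨
    weight (V.head rows)    ≡⟨ cong (weight ∘ V.head) rows-determined ⟩
    weight (W.row 0)        ≡⟨ W.weight-row-zero ⟩
    suc (descents σ)        ∎))
    where open ≡-Reasoning

σ-injective : ∀ {m i} (A B : Alcove (suc m) i) → AlcoveWord.σ A ≡ AlcoveWord.σ B → Alcove.verts A ≡ Alcove.verts B
σ-injective {m} A B σA≡σB = V.reverse-injective (begin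
  AlcoveWord.rows A               ≡⟨ AlcoveWord.rows-determined A ⟩
  Rows.rows m (AlcoveWord.σ↭ A)   ≡⟨ same-rows σA≡σB (AlcoveWord.σ↭ A) (AlcoveWord.σ↭ B) ⟩
  Rows.rows m (AlcoveWord.σ↭ B)   ≡⟨ AlcoveWord.rows-determined B ⟨
  AlcoveWord.rows B               ∎)
  where
  open ≡-Reasoning
  -- the rows depend on the word only, not on the proof that it is a permutation
  same-rows : ∀ {w w′} → w ≡ w′ → (w↭ : w ↭ L.map suc (upTo (suc m))) (w′↭ : w′ ↭ L.map suc (upTo (suc m))) →
              Rows.rows m w↭ ≡ Rows.rows m w′↭
  same-rows refl w↭ w′↭ = refl

module WordAlcove {m i} (1≤i : 1 ≤ i) {w} (eulerian : Eulerian (suc m) i w) where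

  open Rows m (proj₁ eulerian)

  weight-top : weight (row 0) ≡ i
  weight-top = trans weight-row-zero (trans (cong suc (proj₂ eulerian)) (m+[n∸m]≡n 1≤i))

  moveChain : MoveChain (V.reverse rows)
  moveChain = record
    { labels = V.reverse labels
    ; moves = Chain-reverse rows-chain
    ; middle = descentVector
    ; starts = trans (head-reverse rows) rows-last
    ; ends = trans (last′-reverse rows) row-zero
    }

  alcove : Alcove (suc m) i
  alcove = moveChain-alcove moveChain (Unique-reverse labels-unique) weight-head 1≤i
    where
    weight-head : weight (V.head (V.reverse rows)) ≡ i
    weight-head = trans (sym (All.lookup (Chain-weight (Chain-reverse rows-chain)) (last′-∈ (V.reverse rows))))
                        (trans (cong weight (last′-reverse rows)) weight-top)

  σ-alcove : AlcoveWord.σ alcove ≡ w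
  σ-alcove = begin
    markWord (suc m) i (V.reverse (V.reverse rows))   ≡⟨ cong (markWord (suc m) i) (V.reverse-involutive rows) ⟩
    σ                                                 ≡⟨ word-determined σ (Rows.length-w m markWord-↭) σ-at-position ⟩
    w                                                 ∎
    where
    open DecoratedMatrix rows-chain row-zero rows-last weight-top using (markWord-↭; markWord-at-label)
    open ≡-Reasoning
    σ : List ℕ
    σ = markWord (suc m) i rows
    σ-at-position : ∀ a → nth σ (toℕ (position a)) ≡ suc (toℕ a)
    σ-at-position a = trans (cong (nth σ ∘ toℕ) (sym (V.lookup∘tabulate position a))) (markWord-at-label a)

theorem3p26 : (d i : ℕ) → 1 ≤ d → 1 ≤ i → i ≤ d →
    Σ (Alcove d i → List ℕ) λ σ →
      (∀ A → SigmaOf A (σ A) × (∀ w → SigmaOf A w → w ≡ σ A) × Eulerian d i (σ A))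
      × (∀ A B → σ A ≡ σ B → Alcove.verts A ≡ Alcove.verts B)
      × (∀ w → Eulerian d i w → Σ (Alcove d i) λ A → σ A ≡ w)
theorem3p26 zero i () _ _
theorem3p26 (suc m) i _ 1≤i _ =
  AlcoveWord.σ ,
  (λ A → AlcoveWord.sigma A , AlcoveWord.sigma-unique A , AlcoveWord.eulerian A) ,
  σ-injective ,
  λ w eulerian → WordAlcove.alcove 1≤i eulerian , WordAlcove.σ-alcove 1≤i eulerian
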